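{- Let $\alpha$ be a peak composition. Then $$\widehat{P}_{\alpha}(X)=\sum_{T\in MPCT^*(\alpha)}M_{\mathrm{wt}(T)}(X),\qquad \widehat{Q}_{\alpha}(X)=\sum_{T\in MPCT(\alpha)}M_{\mathrm{wt}(T)}(X).$$
   Context: A composition of $n$ is a finite sequence of positive integers with sum $n$; $\ell(\alpha)$ is its number of parts. A peak composition is a composition in which no part except possibly the last equals $1$. The diagram of $\alpha=(\alpha_1,\dots,\alpha_k)$ consists of left-justified rows of boxes, row $i$ (counted from the top) having $\alpha_i$ boxes. For variables $x_1,x_2,\dots$ and a composition $\beta=(\beta_1,\dots,\beta_m)$, $M_\beta(X)=\sum_{i_1<\cdots<i_m}x_{i_1}^{\beta_1}\cdots x_{i_m}^{\beta_m}$. A peak composition tableau of shape $\alpha$ is a filling of the diagram of $\alpha$ with positive integers such that: (1) each row weakly increases from left to right; (2) the first column strictly increases from top to bottom; (3) for every $k\ge1$, the numbers of cells with entry $\le k$ in each row, read from top to bottom and omitting rows containing no such cell, form a peak composition. Its weight $\mathrm{wt}(T)$ has $i$-th entry equal to the number of entries equal to $i$. $PCT(\alpha)$ is the set of such tableaux whose weight is a composition (i.e. the set of entries is $\{1,\dots,m\}$ for some $m$). For $T\in PCT(\alpha)$, $p(T)=\sum_i(\text{number of distinct entries in row } i \text{ minus } 1)$, and $m(T)$ is the number of boxes in the first column whose box immediately below and box immediately to the right contain the same number. Define $\widehat P_\alpha(X)=\sum_{T\in PCT(\alpha)}2^{p(T)-m(T)}M_{\mathrm{wt}(T)}(X)$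 and $\widehat Q_\alpha(X)=2^{\ell(\alpha)}\widehat P_\alpha(X)$. A marked peak composition tableau of shape $\alpha$ is a filling of the diagram of $\alpha$ with letters from the totally ordered alphabet $1'<1<2'<2<3'<3<\cdots$ such that: (1) each row weakly increases from left to right and no marked letter $i'$ appears twice in the same row; (2) the first column strictly increases from top to bottom; (3) for every $k\ge1$, the numbers of cells with entry in $\{1',1,\dots,k',k\}$ in each row, read from top to bottom and omitting rows containing none, form a peak composition; (4) if a box in the first column has an unmarked letter $i$ in the box immediately to its right, then the box immediately below it does not contain $i$ or $i'$. Its weight $\mathrm{wt}(T)$ has $i$-th entry equal to the number of entries equal to $i$ or $i'$. $MPCT(\alpha)$ is the set of such tableaux whose weight is a composition (no value skipped), and $MPCT^*(\alpha)$ is the subset of those with no marked entries in the first column. -}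

module Defs where

open import Data.Bool using (Bool; true; false; _∧_; _∨_; not; if_then_else_)
open import Data.Nat using (ℕ; zero; suc; _+_; _*_; _∸_; _^_; _≡ᵇ_; _≤ᵇ_; _<ᵇ_; _⊔_)
open import Data.List using (List; []; _∷_; map; concat; concatMap; length; filterᵇ; upTo; foldr; deduplicate)
open import Data.Nat.ListAction using (sum)
open import Data.Bool.ListAction using (all)
open import Data.List.Properties using (≡-dec)
open import Data.Nat.Properties using (_≟_)
open import Relation.Nullary.Decidable using (does)

isComposition : List ℕ → Bool
isComposition = all (λ a → 1 ≤ᵇ a)

noOneBeforeLast : List ℕ → Bool
noOneBeforeLast []           = true
noOneBeforeLast (x ∷ [])     = true
noOneBeforeLast (x ∷ y ∷ xs) = not (x ≡ᵇ 1) ∧ noOneBeforeLast (y ∷ xs)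

isPeakComposition : List ℕ → Bool
isPeakComposition α = isComposition α ∧ noOneBeforeLast α

-- Formal power series in x₁, x₂, … with ℕ coefficients, given by their
-- coefficient function: γ = (γ₁,…,γₙ) stands for the monomial x₁^γ₁⋯xₙ^γₙ.

Series : Set
Series = List ℕ → ℕ

-- M_β(X) = Σ_{i₁<⋯<iₘ} x_{i₁}^{β₁}⋯x_{iₘ}^{βₘ}  (β a composition):
-- the coefficient of x^γ is 1 iff the nonzero exponents of γ, in order, are β.
M : List ℕ → Series
M β γ = if does (≡-dec _≟_ (filterᵇ (λ a → not (a ≡ᵇ 0)) γ) β) then 1 else 0

words : {A : Set} → ℕ → List A → List (List A)
words zero    L = [] ∷ []
words (suc n) L = concatMap (λ x → map (x ∷_) (words n L)) L

fillings : {A : Set} → List ℕ → List A → List (List (List A))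
fillings []      L = [] ∷ []
fillings (a ∷ α) L = concatMap (λ r → map (r ∷_) (fillings α L)) (words a L)

weaklyInc : {A : Set} → (A → A → Bool) → List A → Bool
weaklyInc le []           = true
weaklyInc le (x ∷ [])     = true
weaklyInc le (x ∷ y ∷ xs) = le x y ∧ weaklyInc le (y ∷ xs)

-- first-column entries (rows are nonempty for composition shapes)
firstColumn : {A : Set} → List (List A) → List A
firstColumn []             = []
firstColumn ([] ∷ rs)      = firstColumn rs
firstColumn ((x ∷ _) ∷ rs) = x ∷ firstColumn rs

countLe : {A : Set} → (A → ℕ) → ℕ → List A → ℕ
countLe v k r = length (filterᵇ (λ x → v x ≤ᵇ k) r)

peakAt : {A : Set} → (A → ℕ) → List (List A) → ℕ → Bool
peakAt v T k =
  isPeakComposition (filterᵇ (λ c → not (c ≡ᵇ 0)) (map (countLe v k) T))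

maxVal : {A : Set} → (A → ℕ) → List (List A) → ℕ
maxVal v T = foldr _⊔_ 0 (map v (concat T))

-- condition (3) for every k ≥ 1. All fillings we enumerate have values
-- ≤ |α| = N, and for k ≥ N the counts do not change, so k ∈ {1,…,N} suffices.
peakCondition : {A : Set} → (A → ℕ) → ℕ → List (List A) → Bool
peakCondition v N T = all (λ j → peakAt v T (suc j)) (upTo N)

countVal : {A : Set} → (A → ℕ) → ℕ → List (List A) → ℕ
countVal v i T = length (filterᵇ (λ x → v x ≡ᵇ i) (concat T))

wt : {A : Set} → (A → ℕ) → List (List A) → List ℕ
wt v T = map (λ j → countVal v (suc j) T) (upTo (maxVal v T))

weightIsComposition : {A : Set} → (A → ℕ) → List (List A) → Bool
weightIsComposition v T = isComposition (wt v T)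

size : List ℕ → ℕ
size = sum

idℕ : ℕ → ℕ
idℕ n = n

strictCol : List ℕ → Bool
strictCol = weaklyIncStrict
  where
  weaklyIncStrict : List ℕ → Bool
  weaklyIncStrict []           = true
  weaklyIncStrict (x ∷ [])     = true
  weaklyIncStrict (x ∷ y ∷ xs) = (x <ᵇ y) ∧ weaklyIncStrict (y ∷ xs)

isPCT : List ℕ → List (List ℕ) → Bool
isPCT α T =
  all (weaklyInc _≤ᵇ_) T ∧
  strictCol (firstColumn T) ∧
  peakCondition idℕ (size α) T ∧
  weightIsComposition idℕ T

posUpTo : ℕ → List ℕ
posUpTo N = map suc (upTo N)

PCT : List ℕ → List (List (List ℕ))
PCT α = filterᵇ (isPCT α) (fillings α (posUpTo (size α)))

pStat : List (List ℕ) → ℕ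
pStat T = sum (map (λ r → length (deduplicate _≟_ r) ∸ 1) T)

mStat : List (List ℕ) → ℕ
mStat []                          = 0
mStat (r ∷ [])                    = 0
mStat ((a ∷ b ∷ r) ∷ (c ∷ s) ∷ T) =
  (if b ≡ᵇ c then 1 else 0) + mStat ((c ∷ s) ∷ T)
mStat (r ∷ s ∷ T)                 = mStat (s ∷ T)

-- Σ_{T ∈ PCT(α)} 2^{p(T)−m(T)} M_{wt(T)}(X).  (m(T) ≤ p(T) always holds,
-- so truncated subtraction is the ordinary one.)
Phat : List ℕ → Series
Phat α γ = sum (map (λ T → 2 ^ (pStat T ∸ mStat T) * M (wt idℕ T) γ) (PCT α))

Qhat : List ℕ → Series
Qhat α γ = 2 ^ length α * Phat α γ

-- letters 1' < 1 < 2' < 2 < ⋯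
data Letter : Set where
  marked   : ℕ → Letter
  unmarked : ℕ → Letter

val : Letter → ℕ
val (marked i)   = i
val (unmarked i) = i

rank : Letter → ℕ
rank (marked i)   = 2 * i
rank (unmarked i) = suc (2 * i)

_≤L_ : Letter → Letter → Bool
x ≤L y = rank x ≤ᵇ rank y

_<L_ : Letter → Letter → Bool
x <L y = rank x <ᵇ rank y

isMarked : Letter → Bool
isMarked (marked _)   = true
isMarked (unmarked _) = false

noRepeatedMarked : List Letter → Bool
noRepeatedMarked []       = true
noRepeatedMarked (x ∷ xs) =
  (if isMarked x then all (λ y → not (isMarked y ∧ (val y ≡ᵇ val x))) xs else true)
  ∧ noRepeatedMarked xs

strictColL : List Letter → Bool
strictColL []           = true
strictColL (x ∷ [])     = true
strictColL (x ∷ y ∷ xs) = (x <L y) ∧ strictColL (y ∷ xs)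

cond4 : List (List Letter) → Bool
cond4 []                                   = true
cond4 (r ∷ [])                             = true
cond4 ((a ∷ unmarked i ∷ r) ∷ (c ∷ s) ∷ T) =
  not (val c ≡ᵇ i) ∧ cond4 ((c ∷ s) ∷ T)
cond4 (r ∷ s ∷ T)                          = cond4 (s ∷ T)

isMPCT : List ℕ → List (List Letter) → Bool
isMPCT α T =
  all (λ r → weaklyInc _≤L_ r ∧ noRepeatedMarked r) T ∧
  strictColL (firstColumn T) ∧
  peakCondition val (size α) T ∧
  cond4 T ∧
  weightIsComposition val T

lettersUpTo : ℕ → List Letter
lettersUpTo N = concatMap (λ j → marked (suc j) ∷ unmarked (suc j) ∷ []) (upTo N)

MPCT : List ℕ → List (List (List Letter))
MPCT α = filterᵇ (isMPCT α) (fillings α (lettersUpTo (size α)))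

MPCT* : List ℕ → List (List (List Letter))
MPCT* α = filterᵇ (λ T → all (λ x → not (isMarked x)) (firstColumn T)) (MPCT α)

sumM : List (List (List Letter)) → Series
sumM S γ = sum (map (λ T → M (wt val T) γ) S)

-- A marked tableau is a filling X by values together with a mark on every cell, and for fixed X
-- the conditions on the marks are local: they compare each letter with its left neighbour and the
-- start of a row with the first entry of the row below. A letter can be marked only when its value
-- exceeds that of its left neighbour, so a weakly increasing row with d distinct values has
-- 2^(d-1) markings with unmarked first letter, and condition (4) halves this count exactly in the
-- situations counted by m(T). Hence the markings of X with unmarked first column number
-- 2^(p(T)-m(T)) when X ∈ PCT(α) and none otherwise, which is the identity for P̂. For Q̂ the
-- first-column marks are free: a first-column a′ directly above a first-column a would put a part
-- 1 before the last part of the row counts at k = a, so these marks never affect the strict first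
-- column, and each of the ℓ(α) rows doubles the count.

module Submission where

open import Defs
open import Data.Bool using (Bool; true; false; _∧_; not; if_then_else_; T)
open import Data.Bool.Properties using (∧-zeroʳ; ∧-identityʳ; ∧-commutativeMonoid; ⇔→≡)
open import Data.Bool.ListAction using (and; all)
open import Data.Empty using (⊥; ⊥-elim)
open import Data.List using (List; []; _∷_; map; drop; concat; concatMap; length; filterᵇ; filter; upTo; foldr; deduplicate; _++_)
open import Data.List.Properties
  using (map-++; map-∘; map-cong; map-id; length-map; concat-map; concatMap-map; filter-idem; filter-all; filter-reject)
open import Data.List.Membership.Propositional using (_∈_)
open import Data.List.Membership.Propositional.Properties using (∈-upTo⁺)
open import Data.List.Relation.Unary.All as All using (All; []; _∷_)
open import Data.List.Relation.Unary.All.Properties using (all-upTo; deduplicate⁺)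
open import Data.List.Relation.Unary.Any using (here; there)
open import Data.List.Relation.Binary.Pointwise using (Pointwise; []; _∷_)
open import Data.Maybe using (Maybe; just; nothing)
open import Data.Nat using (ℕ; zero; suc; _+_; _*_; _∸_; _^_; _≡ᵇ_; _≤ᵇ_; _<ᵇ_; _⊔_; _≤_; _<_; z≤n; s≤s)
open import Data.Nat.ListAction using (sum)
open import Data.Nat.ListAction.Properties using (sum-++)
open import Data.Nat.Properties
open import Data.Nat.Tactic.RingSolver using (solve-∀)
open import Data.Product using (_×_; _,_; proj₁; proj₂)
open import Data.Unit using (⊤; tt)
open import Function using (_∘_; case_of_)
open import Function.Bundles using (mk⇔)
open import Relation.Binary using (tri<; tri≈; tri>)
open import Relation.Binary.PropositionalEquality
open import Relation.Nullary using (¬_; yes; no; ¬?)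

open import Algebra.Solver.CommutativeMonoid ∧-commutativeMonoid using (solve; _⊕_; _⊜_)

∑ : {A : Set} → List A → (A → ℕ) → ℕ
∑ xs f = sum (map f xs)

syntax ∑ xs (λ x → e) = ∑[ x ← xs ] e

𝟙 : Bool → ℕ
𝟙 true  = 1
𝟙 false = 0

𝟙-∧ : ∀ a b → 𝟙 (a ∧ b) ≡ 𝟙 a * 𝟙 b
𝟙-∧ true  b = sym (+-identityʳ (𝟙 b))
𝟙-∧ false b = refl

𝟙-*-cong : ∀ b {x y} → (b ≡ true → x ≡ y) → 𝟙 b * x ≡ 𝟙 b * y
𝟙-*-cong true  x≡y = cong (1 *_) (x≡y refl)
𝟙-*-cong false _   = refl

𝟙-*-2^ : ∀ a b s t → 𝟙 a * 2 ^ s * (𝟙 b * 2 ^ t) ≡ 𝟙 (a ∧ b) * 2 ^ (s + t)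
𝟙-*-2^ a b s t rewrite 𝟙-∧ a b | ^-distribˡ-+-* 2 s t = rearrange (𝟙 a) (𝟙 b) (2 ^ s) (2 ^ t)
  where
  rearrange : ∀ x y u w → x * u * (y * w) ≡ x * y * (u * w)
  rearrange = solve-∀

module _ {A : Set} where

  ∑-cong : (xs : List A) {f g : A → ℕ} → (∀ x → f x ≡ g x) → ∑ xs f ≡ ∑ xs g
  ∑-cong xs f≗g = cong sum (map-cong f≗g xs)

  ∑-cong-All : {P : A → Set} (xs : List A) {f g : A → ℕ} →
    All P xs → (∀ x → P x → f x ≡ g x) → ∑ xs f ≡ ∑ xs g
  ∑-cong-All []       []         _   = refl
  ∑-cong-All (x ∷ xs) (px ∷ pxs) f≗g = cong₂ _+_ (f≗g x px) (∑-cong-All xs pxs f≗g)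

  ∑-++ : (xs ys : List A) (f : A → ℕ) → ∑ (xs ++ ys) f ≡ ∑ xs f + ∑ ys f
  ∑-++ xs ys f = trans (cong sum (map-++ f xs ys)) (sum-++ (map f xs) (map f ys))

  ∑-zero : (xs : List A) → ∑[ x ← xs ] 0 ≡ 0
  ∑-zero []       = refl
  ∑-zero (x ∷ xs) = ∑-zero xs

  ∑-+ : (xs : List A) (f g : A → ℕ) → ∑[ x ← xs ] (f x + g x) ≡ ∑ xs f + ∑ xs g
  ∑-+ []       f g = refl
  ∑-+ (x ∷ xs) f g rewrite ∑-+ xs f g = +-+-interchange (f x) (g x) (∑ xs f) (∑ xs g)
    where
    +-+-interchange : ∀ a b c d → a + b + (c + d) ≡ a + c + (b + d)
    +-+-interchange = solve-∀

  ∑-*ˡ : (xs : List A) (c : ℕ) (f : A → ℕ) → ∑[ x ← xs ] (c * f x) ≡ c * ∑ xs f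
  ∑-*ˡ []       c f = sym (*-zeroʳ c)
  ∑-*ˡ (x ∷ xs) c f rewrite ∑-*ˡ xs c f = sym (*-distribˡ-+ c (f x) (∑ xs f))

  ∑-*ʳ : (xs : List A) (c : ℕ) (f : A → ℕ) → ∑[ x ← xs ] (f x * c) ≡ ∑ xs f * c
  ∑-*ʳ xs c f = trans (∑-cong xs (λ x → *-comm (f x) c)) (trans (∑-*ˡ xs c f) (*-comm c (∑ xs f)))

  ∑-filterᵇ : (p : A → Bool) (xs : List A) (f : A → ℕ) →
    ∑ (filterᵇ p xs) f ≡ ∑[ x ← xs ] (𝟙 (p x) * f x)
  ∑-filterᵇ p []       f = refl
  ∑-filterᵇ p (x ∷ xs) f with p x
  ... | true  = cong₂ _+_ (sym (+-identityʳ (f x))) (∑-filterᵇ p xs f)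
  ... | false = ∑-filterᵇ p xs f

module _ {A B : Set} where

  ∑-map : (g : A → B) (xs : List A) (f : B → ℕ) → ∑ (map g xs) f ≡ ∑[ x ← xs ] f (g x)
  ∑-map g xs f = cong sum (sym (map-∘ xs))

  ∑-concatMap : (g : A → List B) (xs : List A) (f : B → ℕ) →
    ∑ (concatMap g xs) f ≡ ∑[ x ← xs ] ∑ (g x) f
  ∑-concatMap g []       f = refl
  ∑-concatMap g (x ∷ xs) f =
    trans (∑-++ (g x) (concatMap g xs) f) (cong (∑ (g x) f +_) (∑-concatMap g xs f))

  ∑-comm : (xs : List A) (ys : List B) (f : A → B → ℕ) →
    ∑[ x ← xs ] ∑[ y ← ys ] f x y ≡ ∑[ y ← ys ] ∑[ x ← xs ] f x y
  ∑-comm []       ys f = sym (∑-zero ys)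
  ∑-comm (x ∷ xs) ys f =
    trans (cong (∑ ys (f x) +_) (∑-comm xs ys f)) (sym (∑-+ ys (f x) (λ y → ∑[ x′ ← xs ] f x′ y)))

module _ {A : Set} where

  ∑-words-suc : (n : ℕ) (xs : List A) (g : List A → ℕ) →
    ∑ (words (suc n) xs) g ≡ ∑[ x ← xs ] ∑[ w ← words n xs ] g (x ∷ w)
  ∑-words-suc n xs g =
    trans (∑-concatMap _ xs g) (∑-cong xs (λ x → ∑-map (x ∷_) (words n xs) g))

  ∑-fillings-cons : (a : ℕ) (α : List ℕ) (xs : List A) (g : List (List A) → ℕ) →
    ∑ (fillings (a ∷ α) xs) g ≡ ∑[ r ← words a xs ] ∑[ X ← fillings α xs ] g (r ∷ X)
  ∑-fillings-cons a α xs g =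
    trans (∑-concatMap _ (words a xs) g) (∑-cong (words a xs) (λ r → ∑-map (r ∷_) (fillings α xs) g))

  ShapeOf : List ℕ → List (List A) → Set
  ShapeOf = Pointwise (λ a r → length r ≡ a)

  ∑-cong-words : {P : A → Set} (n : ℕ) (xs : List A) {f g : List A → ℕ} → All P xs →
    (∀ w → length w ≡ n → All P w → f w ≡ g w) → ∑ (words n xs) f ≡ ∑ (words n xs) g
  ∑-cong-words zero    xs pxs f≗g = cong (_+ 0) (f≗g [] refl [])
  ∑-cong-words (suc n) xs {f} {g} pxs f≗g = begin
    ∑ (words (suc n) xs) f                   ≡⟨ ∑-words-suc n xs f ⟩
    ∑[ x ← xs ] ∑[ w ← words n xs ] f (x ∷ w) ≡⟨ ∑-cong-All xs pxs (λ x px →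
                                                   ∑-cong-words n xs pxs (λ w ∣w∣ pw → f≗g (x ∷ w) (cong suc ∣w∣) (px ∷ pw))) ⟩
    ∑[ x ← xs ] ∑[ w ← words n xs ] g (x ∷ w) ≡⟨ ∑-words-suc n xs g ⟨
    ∑ (words (suc n) xs) g                   ∎
    where open ≡-Reasoning

  ∑-cong-fillings : {P : A → Set} (α : List ℕ) (xs : List A) {f g : List (List A) → ℕ} → All P xs →
    (∀ X → ShapeOf α X → All (All P) X → f X ≡ g X) → ∑ (fillings α xs) f ≡ ∑ (fillings α xs) g
  ∑-cong-fillings []      xs pxs f≗g = cong (_+ 0) (f≗g [] [] [])
  ∑-cong-fillings (a ∷ α) xs {f} {g} pxs f≗g = begin
    ∑ (fillings (a ∷ α) xs) f                          ≡⟨ ∑-fillings-cons a α xs f ⟩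
    ∑[ r ← words a xs ] ∑[ X ← fillings α xs ] f (r ∷ X) ≡⟨ ∑-cong-words a xs pxs (λ r ∣r∣ pr →
                                                             ∑-cong-fillings α xs pxs (λ X sX pX → f≗g (r ∷ X) (∣r∣ ∷ sX) (pr ∷ pX))) ⟩
    ∑[ r ← words a xs ] ∑[ X ← fillings α xs ] g (r ∷ X) ≡⟨ ∑-fillings-cons a α xs g ⟨
    ∑ (fillings (a ∷ α) xs) g                          ∎
    where open ≡-Reasoning

T⇒≡true : ∀ {b} → T b → b ≡ true
T⇒≡true {true} _ = refl

≡true⇒T : ∀ {b} → b ≡ true → T b
≡true⇒T refl = _

¬T⇒≡false : ∀ {b} → ¬ T b → b ≡ false
¬T⇒≡false {false} _  = refl
¬T⇒≡false {true}  ¬b = ⊥-elim (¬b _)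

∧≡true⇒ : ∀ {a b} → (a ∧ b) ≡ true → a ≡ true × b ≡ true
∧≡true⇒ {true} {true} _ = refl , refl

⇒∧≡true : ∀ {a b} → a ≡ true → b ≡ true → (a ∧ b) ≡ true
⇒∧≡true refl refl = refl

not≡true⇒≡false : ∀ {b} → not b ≡ true → b ≡ false
not≡true⇒≡false {false} _ = refl

not≡true⇒≢ : ∀ {b} → not b ≡ true → ¬ b ≡ true
not≡true⇒≢ {false} _ ()

all≡true⁺ : {A : Set} (p : A → Bool) {xs : List A} → All (λ x → p x ≡ true) xs → all p xs ≡ true
all≡true⁺ p []         = refl
all≡true⁺ p (px ∷ pxs) = ⇒∧≡true px (all≡true⁺ p pxs)

all⇒∈ : {A : Set} (p : A → Bool) {x : A} {xs : List A} → x ∈ xs → all p xs ≡ true → p x ≡ true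
all⇒∈ p (here refl) e = proj₁ (∧≡true⇒ e)
all⇒∈ p (there x∈)  e = all⇒∈ p x∈ (proj₂ (∧≡true⇒ e))

<ᵇ≡true⇒< : ∀ {m n} → (m <ᵇ n) ≡ true → m < n
<ᵇ≡true⇒< {m} {n} e = <ᵇ⇒< m n (≡true⇒T e)

<⇒<ᵇ≡true : ∀ {m n} → m < n → (m <ᵇ n) ≡ true
<⇒<ᵇ≡true m<n = T⇒≡true (<⇒<ᵇ m<n)

≥⇒<ᵇ≡false : ∀ {m n} → n ≤ m → (m <ᵇ n) ≡ false
≥⇒<ᵇ≡false {m} {n} n≤m = ¬T⇒≡false (λ t → <⇒≱ (<ᵇ⇒< m n t) n≤m)

≤ᵇ≡true⇒≤ : ∀ {m n} → (m ≤ᵇ n) ≡ true → m ≤ n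
≤ᵇ≡true⇒≤ {m} {n} e = ≤ᵇ⇒≤ m n (≡true⇒T e)

≤⇒≤ᵇ≡true : ∀ {m n} → m ≤ n → (m ≤ᵇ n) ≡ true
≤⇒≤ᵇ≡true m≤n = T⇒≡true (≤⇒≤ᵇ m≤n)

>⇒≤ᵇ≡false : ∀ {m n} → n < m → (m ≤ᵇ n) ≡ false
>⇒≤ᵇ≡false {m} {n} n<m = ¬T⇒≡false (λ t → <⇒≱ n<m (≤ᵇ⇒≤ m n t))

≡⇒≡ᵇ≡true : ∀ {m n} → m ≡ n → (m ≡ᵇ n) ≡ true
≡⇒≡ᵇ≡true {m} {n} m≡n = T⇒≡true (≡⇒≡ᵇ m n m≡n)

≢⇒≡ᵇ≡false : ∀ {m n} → m ≢ n → (m ≡ᵇ n) ≡ false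
≢⇒≡ᵇ≡false {m} {n} m≢n = ¬T⇒≡false (λ t → m≢n (≡ᵇ⇒≡ m n t))

≤ᵇ-trans : ∀ x y z → (x ≤ᵇ y) ≡ true → (y ≤ᵇ z) ≡ true → (x ≤ᵇ z) ≡ true
≤ᵇ-trans x y z p q = ≤⇒≤ᵇ≡true (≤-trans (≤ᵇ≡true⇒≤ {x} {y} p) (≤ᵇ≡true⇒≤ {y} {z} q))

<ᵇ-suc : ∀ m n → (m <ᵇ suc n) ≡ (m ≤ᵇ n)
<ᵇ-suc zero    n = refl
<ᵇ-suc (suc m) n = refl

even-<ᵇ-even : ∀ m n → (2 * m <ᵇ 2 * n) ≡ (m <ᵇ n)
even-<ᵇ-even zero    zero    = refl
even-<ᵇ-even zero    (suc n) = refl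
even-<ᵇ-even (suc m) zero    = refl
even-<ᵇ-even (suc m) (suc n) rewrite +-suc m (m + 0) | +-suc n (n + 0) = even-<ᵇ-even m n

odd-<ᵇ-even : ∀ m n → (suc (2 * m) <ᵇ 2 * n) ≡ (m <ᵇ n)
odd-<ᵇ-even m       zero    = refl
odd-<ᵇ-even zero    (suc n) rewrite +-suc n (n + 0) = refl
odd-<ᵇ-even (suc m) (suc n) rewrite +-suc m (m + 0) | +-suc n (n + 0) = odd-<ᵇ-even m n

even-≤ᵇ-even : ∀ m n → (2 * m ≤ᵇ 2 * n) ≡ (m ≤ᵇ n)
even-≤ᵇ-even zero    n = refl
even-≤ᵇ-even (suc m) n rewrite +-suc m (m + 0) = odd-<ᵇ-even m n

even-≤ᵇ-odd : ∀ m n → (2 * m ≤ᵇ suc (2 * n)) ≡ (m ≤ᵇ n)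
even-≤ᵇ-odd zero    n = refl
even-≤ᵇ-odd (suc m) n rewrite +-suc m (m + 0) = even-<ᵇ-even m n

even-<ᵇ-odd : ∀ m n → (2 * m <ᵇ suc (2 * n)) ≡ (m ≤ᵇ n)
even-<ᵇ-odd m n = trans (<ᵇ-suc (2 * m) (2 * n)) (even-≤ᵇ-even m n)

≤L-mm : ∀ a c → (marked a ≤L marked c) ≡ (a ≤ᵇ c)
≤L-mm = even-≤ᵇ-even

≤L-mu : ∀ a c → (marked a ≤L unmarked c) ≡ (a ≤ᵇ c)
≤L-mu = even-≤ᵇ-odd

≤L-um : ∀ a c → (unmarked a ≤L marked c) ≡ (a <ᵇ c)
≤L-um = even-<ᵇ-even

≤L-uu : ∀ a c → (unmarked a ≤L unmarked c) ≡ (a ≤ᵇ c)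
≤L-uu = even-<ᵇ-odd

<L-mm : ∀ a c → (marked a <L marked c) ≡ (a <ᵇ c)
<L-mm = even-<ᵇ-even

<L-mu : ∀ a c → (marked a <L unmarked c) ≡ (a ≤ᵇ c)
<L-mu = even-<ᵇ-odd

<L-um : ∀ a c → (unmarked a <L marked c) ≡ (a <ᵇ c)
<L-um = odd-<ᵇ-even

<L-uu : ∀ a c → (unmarked a <L unmarked c) ≡ (a <ᵇ c)
<L-uu = even-<ᵇ-even

-- Marked fillings as fillings by values with marks

bools : List Bool
bools = true ∷ false ∷ []

mark : ℕ → Bool → Letter
mark x true  = marked x
mark x false = unmarked x

val-mark : ∀ y b → val (mark y b) ≡ y
val-mark y true  = refl
val-mark y false = refl

markRow : List ℕ → List Bool → List Letter
markRow []      bs       = []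
markRow (x ∷ r) []       = unmarked x ∷ markRow r []
markRow (x ∷ r) (b ∷ bs) = mark x b ∷ markRow r bs

firstRow : List (List Bool) → List Bool
firstRow []      = []
firstRow (bs ∷ _) = bs

markFilling : List (List ℕ) → List (List Bool) → List (List Letter)
markFilling []      B = []
markFilling (r ∷ X) B = markRow r (firstRow B) ∷ markFilling X (drop 1 B)

bothMarks : ℕ → List Letter
bothMarks x = map (mark x) bools

lettersUpTo≡ : ∀ N → lettersUpTo N ≡ concatMap bothMarks (posUpTo N)
lettersUpTo≡ N = sym (concatMap-map bothMarks suc (upTo N))

∑-words-bothMarks : ∀ n (xs : List ℕ) (g : List Letter → ℕ) →
  ∑ (words n (concatMap bothMarks xs)) g ≡ ∑[ r ← words n xs ] ∑[ bs ← words n bools ] g (markRow r bs)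
∑-words-bothMarks zero    xs g = cong (_+ 0) (sym (+-identityʳ (g [])))
∑-words-bothMarks (suc n) xs g = begin
  ∑ (words (suc n) L) g
    ≡⟨ ∑-words-suc n L g ⟩
  ∑[ y ← L ] ∑[ w ← words n L ] g (y ∷ w)
    ≡⟨ ∑-concatMap bothMarks xs _ ⟩
  ∑[ x ← xs ] ∑[ y ← bothMarks x ] ∑[ w ← words n L ] g (y ∷ w)
    ≡⟨ ∑-cong xs (λ x → ∑-map (mark x) bools (λ y → ∑[ w ← words n L ] g (y ∷ w))) ⟩
  ∑[ x ← xs ] ∑[ b ← bools ] ∑[ w ← words n L ] g (mark x b ∷ w)
    ≡⟨ ∑-cong xs (λ x → ∑-cong bools (λ b → ∑-words-bothMarks n xs (λ w → g (mark x b ∷ w)))) ⟩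
  ∑[ x ← xs ] ∑[ b ← bools ] ∑[ r ← words n xs ] ∑[ bs ← words n bools ] g (mark x b ∷ markRow r bs)
    ≡⟨ ∑-cong xs (λ x → ∑-comm bools (words n xs) (λ b r → ∑[ bs ← words n bools ] g (mark x b ∷ markRow r bs))) ⟩
  ∑[ x ← xs ] ∑[ r ← words n xs ] ∑[ b ← bools ] ∑[ bs ← words n bools ] g (markRow (x ∷ r) (b ∷ bs))
    ≡⟨ ∑-cong xs (λ x → ∑-cong (words n xs) (λ r → ∑-words-suc n bools (λ bs → g (markRow (x ∷ r) bs)))) ⟨
  ∑[ x ← xs ] ∑[ r ← words n xs ] ∑[ bs ← words (suc n) bools ] g (markRow (x ∷ r) bs)
    ≡⟨ ∑-words-suc n xs (λ r → ∑[ bs ← words (suc n) bools ] g (markRow r bs)) ⟨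
  ∑[ r ← words (suc n) xs ] ∑[ bs ← words (suc n) bools ] g (markRow r bs)
    ∎
  where
  open ≡-Reasoning
  L = concatMap bothMarks xs

∑-fillings-bothMarks : ∀ α (xs : List ℕ) (g : List (List Letter) → ℕ) →
  ∑ (fillings α (concatMap bothMarks xs)) g ≡ ∑[ X ← fillings α xs ] ∑[ B ← fillings α bools ] g (markFilling X B)
∑-fillings-bothMarks []      xs g = cong (_+ 0) (sym (+-identityʳ (g [])))
∑-fillings-bothMarks (a ∷ α) xs g = begin
  ∑ (fillings (a ∷ α) L) g
    ≡⟨ ∑-fillings-cons a α L g ⟩
  ∑[ w ← words a L ] ∑[ Y ← fillings α L ] g (w ∷ Y)
    ≡⟨ ∑-cong (words a L) (λ w → ∑-fillings-bothMarks α xs (λ Y → g (w ∷ Y))) ⟩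
  ∑[ w ← words a L ] ∑[ X ← fillings α xs ] ∑[ B ← fillings α bools ] g (w ∷ markFilling X B)
    ≡⟨ ∑-words-bothMarks a xs _ ⟩
  ∑[ r ← words a xs ] ∑[ bs ← words a bools ] ∑[ X ← fillings α xs ] ∑[ B ← fillings α bools ] g (markRow r bs ∷ markFilling X B)
    ≡⟨ ∑-cong (words a xs) (λ r → ∑-comm (words a bools) (fillings α xs)
         (λ bs X → ∑[ B ← fillings α bools ] g (markRow r bs ∷ markFilling X B))) ⟩
  ∑[ r ← words a xs ] ∑[ X ← fillings α xs ] ∑[ bs ← words a bools ] ∑[ B ← fillings α bools ] g (markFilling (r ∷ X) (bs ∷ B))
    ≡⟨ ∑-cong (words a xs) (λ r → ∑-cong (fillings α xs) (λ X → ∑-fillings-cons a α bools (λ B → g (markFilling (r ∷ X) B)))) ⟨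
  ∑[ r ← words a xs ] ∑[ X ← fillings α xs ] ∑[ B ← fillings (a ∷ α) bools ] g (markFilling (r ∷ X) B)
    ≡⟨ ∑-fillings-cons a α xs (λ X → ∑[ B ← fillings (a ∷ α) bools ] g (markFilling X B)) ⟨
  ∑[ X ← fillings (a ∷ α) xs ] ∑[ B ← fillings (a ∷ α) bools ] g (markFilling X B)
    ∎
  where
  open ≡-Reasoning
  L = concatMap bothMarks xs

∑-letterFillings : ∀ α (g : List (List Letter) → ℕ) →
  ∑ (fillings α (lettersUpTo (size α))) g ≡ ∑[ X ← fillings α (posUpTo (size α)) ] ∑[ B ← fillings α bools ] g (markFilling X B)
∑-letterFillings α g =
  trans (cong (λ L → ∑ (fillings α L) g) (lettersUpTo≡ (size α))) (∑-fillings-bothMarks α (posUpTo (size α)) g)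

map-val-markRow : ∀ r bs → map val (markRow r bs) ≡ r
map-val-markRow []      bs           = refl
map-val-markRow (x ∷ r) []           = cong (x ∷_) (map-val-markRow r [])
map-val-markRow (x ∷ r) (true ∷ bs)  = cong (x ∷_) (map-val-markRow r bs)
map-val-markRow (x ∷ r) (false ∷ bs) = cong (x ∷_) (map-val-markRow r bs)

map-val-markFilling : ∀ X B → map (map val) (markFilling X B) ≡ X
map-val-markFilling []      B = refl
map-val-markFilling (r ∷ X) B = cong₂ _∷_ (map-val-markRow r (firstRow B)) (map-val-markFilling X (drop 1 B))

module _ {A B : Set} where

  filterᵇ-map : (p : B → Bool) (f : A → B) (xs : List A) →
    filterᵇ p (map f xs) ≡ map f (filterᵇ (p ∘ f) xs)
  filterᵇ-map p f []       = refl
  filterᵇ-map p f (x ∷ xs) with p (f x)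
  ... | true  = cong (f x ∷_) (filterᵇ-map p f xs)
  ... | false = filterᵇ-map p f xs

module _ {A : Set} (v : A → ℕ) where

  countLe-map : ∀ k r → countLe v k r ≡ countLe idℕ k (map v r)
  countLe-map k r =
    trans (sym (length-map v (filterᵇ (λ x → v x ≤ᵇ k) r))) (cong length (sym (filterᵇ-map (_≤ᵇ k) v r)))

  peakCondition-map : ∀ N X → peakCondition v N X ≡ peakCondition idℕ N (map (map v) X)
  peakCondition-map N X = cong and (map-cong (λ j → cong (peak (suc j)) (counts (suc j))) (upTo N))
    where
    peak : ℕ → List ℕ → Bool
    peak k cs = isPeakComposition (filterᵇ (λ c → not (c ≡ᵇ 0)) cs)
    counts : ∀ k → map (countLe v k) X ≡ map (countLe idℕ k) (map (map v) X)
    counts k = trans (map-cong (countLe-map k) X) (map-∘ X)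

  countVal-map : ∀ i X → countVal v i X ≡ countVal idℕ i (map (map v) X)
  countVal-map i X = begin
    length (filterᵇ (λ x → v x ≡ᵇ i) (concat X))            ≡⟨ length-map v (filterᵇ (λ x → v x ≡ᵇ i) (concat X)) ⟨
    length (map v (filterᵇ (λ x → v x ≡ᵇ i) (concat X)))    ≡⟨ cong length (filterᵇ-map (_≡ᵇ i) v (concat X)) ⟨
    length (filterᵇ (_≡ᵇ i) (map v (concat X)))             ≡⟨ cong (length ∘ filterᵇ (_≡ᵇ i)) (concat-map X) ⟨
    length (filterᵇ (_≡ᵇ i) (concat (map (map v) X)))       ∎
    where open ≡-Reasoning

  maxVal-map : ∀ X → maxVal v X ≡ maxVal idℕ (map (map v) X)
  maxVal-map X = cong (foldr _⊔_ 0) (sym (trans (map-id _) (concat-map X)))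

  wt-map : ∀ X → wt v X ≡ wt idℕ (map (map v) X)
  wt-map X rewrite maxVal-map X = map-cong (λ j → countVal-map (suc j) X) (upTo _)

wt-markFilling : ∀ X B → wt val (markFilling X B) ≡ wt idℕ X
wt-markFilling X B = trans (wt-map val (markFilling X B)) (cong (wt idℕ) (map-val-markFilling X B))

peakCondition-markFilling : ∀ N X B → peakCondition val N (markFilling X B) ≡ peakCondition idℕ N X
peakCondition-markFilling N X B =
  trans (peakCondition-map val N (markFilling X B)) (cong (peakCondition idℕ N) (map-val-markFilling X B))

-- Markings of a single row

module _ {A : Set} (le : A → A → Bool) where

  weaklyInc-tail : ∀ x r → weaklyInc le (x ∷ r) ≡ true → weaklyInc le r ≡ true
  weaklyInc-tail x []      _ = refl
  weaklyInc-tail x (y ∷ r) c = proj₂ (∧≡true⇒ c)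

  weaklyInc-head : (∀ x y z → le x y ≡ true → le y z ≡ true → le x z ≡ true) →
    ∀ x r → weaklyInc le (x ∷ r) ≡ true → All (λ y → le x y ≡ true) r
  weaklyInc-head le-trans x []      _ = []
  weaklyInc-head le-trans x (y ∷ r) c =
    x≤y ∷ All.map (λ {z} → le-trans x y z x≤y) (weaklyInc-head le-trans y r (proj₂ (∧≡true⇒ c)))
    where
    x≤y : le x y ≡ true
    x≤y = proj₁ (∧≡true⇒ c)

precedes : Letter → Letter → Bool
precedes x y = if isMarked y then val x <ᵇ val y else val x ≤ᵇ val y

precedes⇒val≤ : ∀ x y → precedes x y ≡ true → val x ≤ val y
precedes⇒val≤ x (marked c)   p = <⇒≤ (<ᵇ≡true⇒< {val x} {c} p)
precedes⇒val≤ x (unmarked c) p = ≤ᵇ≡true⇒≤ {val x} p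

precedes-trans : ∀ x y z → precedes x y ≡ true → precedes y z ≡ true → precedes x z ≡ true
precedes-trans x y (marked c)   p q =
  <⇒<ᵇ≡true {val x} {c} (≤-<-trans (precedes⇒val≤ x y p) (<ᵇ≡true⇒< {val y} {c} q))
precedes-trans x y (unmarked c) p q = ≤⇒≤ᵇ≡true (≤-trans (precedes⇒val≤ x y p) (≤ᵇ≡true⇒≤ {val y} q))

precedes⇒≤L : ∀ x y → precedes x y ≡ true → (x ≤L y) ≡ true
precedes⇒≤L (marked a)   (marked c)   p = trans (≤L-mm a c) (≤⇒≤ᵇ≡true (<⇒≤ (<ᵇ≡true⇒< {a} {c} p)))
precedes⇒≤L (unmarked a) (marked c)   p = trans (≤L-um a c) p
precedes⇒≤L (marked a)   (unmarked c) p = trans (≤L-mu a c) p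
precedes⇒≤L (unmarked a) (unmarked c) p = trans (≤L-uu a c) p

precedes⇒distinctMarked : ∀ x y → precedes x y ≡ true → not (isMarked y ∧ (val y ≡ᵇ val x)) ≡ true
precedes⇒distinctMarked x (marked c)   p = cong not (≢⇒≡ᵇ≡false {c} (>⇒≢ (<ᵇ≡true⇒< {val x} {c} p)))
precedes⇒distinctMarked x (unmarked c) p = refl

chain⇒weaklyInc : ∀ r → weaklyInc precedes r ≡ true → weaklyInc _≤L_ r ≡ true
chain⇒weaklyInc []          _ = refl
chain⇒weaklyInc (x ∷ [])     _ = refl
chain⇒weaklyInc (x ∷ y ∷ r) c =
  ⇒∧≡true (precedes⇒≤L x y (proj₁ (∧≡true⇒ c))) (chain⇒weaklyInc (y ∷ r) (proj₂ (∧≡true⇒ c)))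

chain⇒noRepeatedMarked : ∀ r → weaklyInc precedes r ≡ true → noRepeatedMarked r ≡ true
chain⇒noRepeatedMarked []               _ = refl
chain⇒noRepeatedMarked (marked a ∷ r)   c =
  ⇒∧≡true (all≡true⁺ _ (All.map (λ {y} → precedes⇒distinctMarked (marked a) y)
                                 (weaklyInc-head precedes precedes-trans (marked a) r c)))
          (chain⇒noRepeatedMarked r (weaklyInc-tail precedes (marked a) r c))
chain⇒noRepeatedMarked (unmarked a ∷ r) c = chain⇒noRepeatedMarked r (weaklyInc-tail precedes (unmarked a) r c)

≤L⇒precedes : ∀ x y → (x ≤L y) ≡ true →
  (isMarked x ≡ true → not (isMarked y ∧ (val y ≡ᵇ val x)) ≡ true) → precedes x y ≡ true
≤L⇒precedes (marked a)   (marked c)   l d =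
  <⇒<ᵇ≡true {a} {c} (≤∧≢⇒< (≤ᵇ≡true⇒≤ {a} {c} (trans (sym (≤L-mm a c)) l)) a≢c)
  where
  a≢c : a ≢ c
  a≢c refl = case trans (sym (≡⇒≡ᵇ≡true {a} refl)) (not≡true⇒≡false (d refl)) of λ ()
≤L⇒precedes (marked a)   (unmarked c) l _ = trans (sym (≤L-mu a c)) l
≤L⇒precedes (unmarked a) (marked c)   l _ = trans (sym (≤L-um a c)) l
≤L⇒precedes (unmarked a) (unmarked c) l _ = trans (sym (≤L-uu a c)) l

weaklyInc∧noRepeatedMarked⇒chain : ∀ r → weaklyInc _≤L_ r ≡ true → noRepeatedMarked r ≡ true →
  weaklyInc precedes r ≡ true
weaklyInc∧noRepeatedMarked⇒chain []          _ _ = refl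
weaklyInc∧noRepeatedMarked⇒chain (x ∷ [])     _ _ = refl
weaklyInc∧noRepeatedMarked⇒chain (x ∷ y ∷ r) w n =
  ⇒∧≡true (≤L⇒precedes x y (proj₁ (∧≡true⇒ w)) (headDistinct x (proj₁ n′)))
          (weaklyInc∧noRepeatedMarked⇒chain (y ∷ r) (proj₂ (∧≡true⇒ w)) (proj₂ n′))
  where
  distinctFrom : Letter → List Letter → Bool
  distinctFrom x = all (λ z → not (isMarked z ∧ (val z ≡ᵇ val x)))
  n′ = ∧≡true⇒ {if isMarked x then distinctFrom x (y ∷ r) else true} n
  headDistinct : ∀ x → (if isMarked x then distinctFrom x (y ∷ r) else true) ≡ true →
    isMarked x ≡ true → not (isMarked y ∧ (val y ≡ᵇ val x)) ≡ true
  headDistinct (marked a) h _ = proj₁ (∧≡true⇒ h)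

rowCondition≡chain : ∀ r → (weaklyInc _≤L_ r ∧ noRepeatedMarked r) ≡ weaklyInc precedes r
rowCondition≡chain r = ⇔→≡ (mk⇔
  (λ h → weaklyInc∧noRepeatedMarked⇒chain r (proj₁ (∧≡true⇒ h)) (proj₂ (∧≡true⇒ h)))
  (λ c → ⇒∧≡true (chain⇒weaklyInc r c) (chain⇒noRepeatedMarked r c)))

ascents : ℕ → List ℕ → ℕ
ascents x []      = 0
ascents x (y ∷ r) = (if x ≡ᵇ y then 0 else 1) + ascents y r

ascentsRow : List ℕ → ℕ
ascentsRow []      = 0
ascentsRow (a ∷ r) = ascents a r

filter-≢-above : ∀ a b r → a < b → weaklyInc _≤ᵇ_ (b ∷ r) ≡ true →
  filter (¬? ∘ (a ≟_)) (deduplicate _≟_ (b ∷ r)) ≡ deduplicate _≟_ (b ∷ r)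
filter-≢-above a b r a<b w =
  filter-all (¬? ∘ (a ≟_))
    (deduplicate⁺ _≟_ (All.map a≢ (≤⇒≤ᵇ≡true (≤-refl {b}) ∷ weaklyInc-head _≤ᵇ_ ≤ᵇ-trans b r w)))
  where
  a≢ : ∀ {x} → (b ≤ᵇ x) ≡ true → ¬ (a ≡ x)
  a≢ b≤x = <⇒≢ (<-≤-trans a<b (≤ᵇ≡true⇒≤ {b} b≤x))

deduplicate-length : ∀ a r → weaklyInc _≤ᵇ_ (a ∷ r) ≡ true → length (deduplicate _≟_ (a ∷ r)) ≡ suc (ascents a r)
deduplicate-length a []      _ = refl
deduplicate-length a (b ∷ r) w with <-cmp a b
... | tri< a<b _ _ rewrite filter-≢-above a b r a<b (weaklyInc-tail _≤ᵇ_ a (b ∷ r) w) | ≢⇒≡ᵇ≡false (<⇒≢ a<b) =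
  cong suc (deduplicate-length b r (weaklyInc-tail _≤ᵇ_ a (b ∷ r) w))
... | tri≈ _ refl _
  rewrite filter-reject (¬? ∘ (a ≟_)) {x = a} {xs = filter (¬? ∘ (a ≟_)) (deduplicate _≟_ r)} (λ ¬a≡a → ¬a≡a refl)
                          | filter-idem (¬? ∘ (a ≟_)) (deduplicate _≟_ r) | ≡⇒≡ᵇ≡true {a} refl =
  deduplicate-length a r (weaklyInc-tail _≤ᵇ_ a (a ∷ r) w)
... | tri> _ _ a>b = ⊥-elim (<⇒≱ a>b (≤ᵇ≡true⇒≤ {a} {b} (proj₁ (∧≡true⇒ w))))

distinct∸1≡ascentsRow : ∀ r → weaklyInc _≤ᵇ_ r ≡ true → length (deduplicate _≟_ r) ∸ 1 ≡ ascentsRow r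
distinct∸1≡ascentsRow []      _ = refl
distinct∸1≡ascentsRow (a ∷ r) w = cong (_∸ 1) (deduplicate-length a r w)

markedChains : Letter → List ℕ → ℕ
markedChains x r = ∑[ bs ← words (length r) bools ] 𝟙 (weaklyInc precedes (x ∷ markRow r bs))

markedChains-cons : ∀ x y r →
  markedChains x (y ∷ r) ≡ ∑[ b ← bools ] (𝟙 (precedes x (mark y b)) * markedChains (mark y b) r)
markedChains-cons x y r =
  trans (∑-words-suc (length r) bools (λ bs → 𝟙 (weaklyInc precedes (x ∷ markRow (y ∷ r) bs))))
    (∑-cong bools (λ b → trans
      (∑-cong (words (length r) bools) (λ bs → 𝟙-∧ (precedes x (mark y b)) (chain b bs)))
      (∑-*ˡ (words (length r) bools) (𝟙 (precedes x (mark y b))) (λ bs → 𝟙 (chain b bs)))))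
  where
  chain : Bool → List Bool → Bool
  chain b bs = weaklyInc precedes (mark y b ∷ markRow r bs)

markings-of-next : ∀ v y → 𝟙 (v <ᵇ y) + (𝟙 (v ≤ᵇ y) + 0) ≡ 𝟙 (v ≤ᵇ y) * 2 ^ (if v ≡ᵇ y then 0 else 1)
markings-of-next v y with <-cmp v y
... | tri< v<y _ _ rewrite <⇒<ᵇ≡true v<y | ≤⇒≤ᵇ≡true (<⇒≤ v<y) | ≢⇒≡ᵇ≡false (<⇒≢ v<y) = refl
... | tri≈ _ refl _ rewrite ≥⇒<ᵇ≡false (≤-refl {v}) | ≤⇒≤ᵇ≡true (≤-refl {v}) | ≡⇒≡ᵇ≡true {v} refl = refl
... | tri> _ _ v>y rewrite ≥⇒<ᵇ≡false (<⇒≤ v>y) | >⇒≤ᵇ≡false v>y = refl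

-- A letter may be marked only if its value exceeds its left neighbour's, so each strict ascent
-- offers two markings and each repeated value one.
markedChains≡ : ∀ x r → markedChains x r ≡ 𝟙 (weaklyInc _≤ᵇ_ (val x ∷ r)) * 2 ^ ascents (val x) r
markedChains≡ x []      = refl
markedChains≡ x (y ∷ r) = begin
  markedChains x (y ∷ r)
    ≡⟨ markedChains-cons x y r ⟩
  ∑[ b ← bools ] (𝟙 (precedes x (mark y b)) * markedChains (mark y b) r)
    ≡⟨ ∑-cong bools (λ b → cong (𝟙 (precedes x (mark y b)) *_) (tail b)) ⟩
  ∑[ b ← bools ] (𝟙 (precedes x (mark y b)) * (𝟙 w * 2 ^ e))
    ≡⟨ ∑-*ʳ bools (𝟙 w * 2 ^ e) (λ b → 𝟙 (precedes x (mark y b))) ⟩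
  (𝟙 (val x <ᵇ y) + (𝟙 (val x ≤ᵇ y) + 0)) * (𝟙 w * 2 ^ e)
    ≡⟨ cong (_* (𝟙 w * 2 ^ e)) (markings-of-next (val x) y) ⟩
  𝟙 (val x ≤ᵇ y) * 2 ^ (if val x ≡ᵇ y then 0 else 1) * (𝟙 w * 2 ^ e)
    ≡⟨ 𝟙-*-2^ (val x ≤ᵇ y) w (if val x ≡ᵇ y then 0 else 1) e ⟩
  𝟙 (weaklyInc _≤ᵇ_ (val x ∷ y ∷ r)) * 2 ^ ascents (val x) (y ∷ r)
    ∎
  where
  open ≡-Reasoning
  w = weaklyInc _≤ᵇ_ (y ∷ r)
  e = ascents y r
  tail : ∀ b → markedChains (mark y b) r ≡ 𝟙 w * 2 ^ e
  tail b = trans (markedChains≡ (mark y b) r) (cong (λ z → 𝟙 (weaklyInc _≤ᵇ_ (z ∷ r)) * 2 ^ ascents z r) (val-mark y b))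

leadingValue : {A : Set} → (A → ℕ) → List (List A) → Maybe ℕ
leadingValue v []            = nothing
leadingValue v ([] ∷ _)      = nothing
leadingValue v ((x ∷ _) ∷ _) = just (v x)

firstUnmarked : List Letter → Bool
firstUnmarked []      = true
firstUnmarked (x ∷ _) = not (isMarked x)

cond4Below : List Letter → Maybe ℕ → Bool
cond4Below m                    nothing  = true
cond4Below (a ∷ unmarked i ∷ r) (just c) = not (c ≡ᵇ i)
cond4Below _                    (just c) = true

admissible : List Letter → Maybe ℕ → Bool
admissible m below = weaklyInc precedes m ∧ (firstUnmarked m ∧ cond4Below m below)

admissibleMarkings : List ℕ → Maybe ℕ → ℕ
admissibleMarkings r below = ∑[ bs ← words (length r) bools ] 𝟙 (admissible (markRow r bs) below)

mBelow : List ℕ → Maybe ℕ → ℕ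
mBelow r           nothing  = 0
mBelow (a ∷ b ∷ r) (just c) = if b ≡ᵇ c then 1 else 0
mBelow _           (just c) = 0

StrictlyAbove : List ℕ → Maybe ℕ → Set
StrictlyAbove (a ∷ _) (just c) = a < c
StrictlyAbove _       _        = ⊤

admissibleMarkings-cons : ∀ a r below → admissibleMarkings (a ∷ r) below ≡
  ∑[ bs ← words (length r) bools ] 𝟙 (weaklyInc precedes (unmarked a ∷ markRow r bs) ∧ cond4Below (unmarked a ∷ markRow r bs) below)
admissibleMarkings-cons a r below = begin
  admissibleMarkings (a ∷ r) below
    ≡⟨ ∑-words-suc (length r) bools (λ bs → 𝟙 (admissible (markRow (a ∷ r) bs) below)) ⟩
  ∑[ bs ← ws ] 𝟙 (admissible (marked a ∷ markRow r bs) below) + (unmarkedFirst + 0)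
    ≡⟨ cong (λ z → z + (unmarkedFirst + 0)) (trans (∑-cong ws markedFirst) (∑-zero ws)) ⟩
  unmarkedFirst + 0
    ≡⟨ +-identityʳ unmarkedFirst ⟩
  unmarkedFirst
    ∎
  where
  open ≡-Reasoning
  ws = words (length r) bools
  unmarkedFirst = ∑[ bs ← ws ] 𝟙 (weaklyInc precedes (unmarked a ∷ markRow r bs) ∧ cond4Below (unmarked a ∷ markRow r bs) below)
  markedFirst : ∀ bs → 𝟙 (admissible (marked a ∷ markRow r bs) below) ≡ 0
  markedFirst bs = cong 𝟙 (∧-zeroʳ (weaklyInc precedes (marked a ∷ markRow r bs)))

admissibleMarkings-unconstrained : ∀ a r below → (∀ bs → cond4Below (unmarked a ∷ markRow r bs) below ≡ true) →
  admissibleMarkings (a ∷ r) below ≡ markedChains (unmarked a) r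
admissibleMarkings-unconstrained a r below c4 = trans (admissibleMarkings-cons a r below)
  (∑-cong (words (length r) bools) (λ bs →
    cong 𝟙 (trans (cong (weaklyInc precedes (unmarked a ∷ markRow r bs) ∧_) (c4 bs)) (∧-identityʳ _))))

-- When the entry below equals the second entry, condition (4) forces that entry to be marked,
-- which removes exactly the factor 2 of the ascent between the first two entries.
admissibleMarkings-forced : ∀ a c r → a < c →
  admissibleMarkings (a ∷ c ∷ r) (just c) ≡ 𝟙 (weaklyInc _≤ᵇ_ (a ∷ c ∷ r)) * 2 ^ (ascents a (c ∷ r) ∸ 1)
admissibleMarkings-forced a c r a<c = begin
  admissibleMarkings (a ∷ c ∷ r) (just c)
    ≡⟨ admissibleMarkings-cons a (c ∷ r) (just c) ⟩
  ∑[ bs ← words (suc (length r)) bools ] 𝟙 (admissible′ (markRow (c ∷ r) bs))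
    ≡⟨ ∑-words-suc (length r) bools (λ bs → 𝟙 (admissible′ (markRow (c ∷ r) bs))) ⟩
  ∑[ bs ← ws ] 𝟙 (admissible′ (marked c ∷ markRow r bs)) + (∑[ bs ← ws ] 𝟙 (admissible′ (unmarked c ∷ markRow r bs)) + 0)
    ≡⟨ cong₂ (λ x y → x + (y + 0)) (∑-cong ws secondMarked) (trans (∑-cong ws secondUnmarked) (∑-zero ws)) ⟩
  markedChains (marked c) r + 0
    ≡⟨ +-identityʳ _ ⟩
  markedChains (marked c) r
    ≡⟨ markedChains≡ (marked c) r ⟩
  𝟙 (weaklyInc _≤ᵇ_ (c ∷ r)) * 2 ^ ascents c r
    ≡⟨ cong₂ (λ x y → 𝟙 (x ∧ weaklyInc _≤ᵇ_ (c ∷ r)) * 2 ^ ((if y then 0 else 1) + ascents c r ∸ 1))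
             (≤⇒≤ᵇ≡true (<⇒≤ a<c)) (≢⇒≡ᵇ≡false (<⇒≢ a<c)) ⟨
  𝟙 (weaklyInc _≤ᵇ_ (a ∷ c ∷ r)) * 2 ^ (ascents a (c ∷ r) ∸ 1)
    ∎
  where
  open ≡-Reasoning
  ws = words (length r) bools
  admissible′ : List Letter → Bool
  admissible′ m = weaklyInc precedes (unmarked a ∷ m) ∧ cond4Below (unmarked a ∷ m) (just c)
  secondMarked : ∀ bs → 𝟙 (admissible′ (marked c ∷ markRow r bs)) ≡ 𝟙 (weaklyInc precedes (marked c ∷ markRow r bs))
  secondMarked bs rewrite <⇒<ᵇ≡true a<c = cong 𝟙 (∧-identityʳ _)
  secondUnmarked : ∀ bs → 𝟙 (admissible′ (unmarked c ∷ markRow r bs)) ≡ 0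
  secondUnmarked bs rewrite ≡⇒≡ᵇ≡true {c} refl = cong 𝟙 (∧-zeroʳ _)

admissibleMarkings≡ : ∀ r below → StrictlyAbove r below →
  admissibleMarkings r below ≡ 𝟙 (weaklyInc _≤ᵇ_ r) * 2 ^ (ascentsRow r ∸ mBelow r below)
admissibleMarkings≡ []          nothing  _ = refl
admissibleMarkings≡ []          (just c) _ = refl
admissibleMarkings≡ (a ∷ r)     nothing  _ =
  trans (admissibleMarkings-unconstrained a r nothing (λ _ → refl)) (markedChains≡ (unmarked a) r)
admissibleMarkings≡ (a ∷ [])    (just c) _ =
  trans (admissibleMarkings-unconstrained a [] (just c) (λ _ → refl)) (markedChains≡ (unmarked a) [])
admissibleMarkings≡ (a ∷ y ∷ r) (just c) a<c with y ≟ c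
... | yes refl rewrite ≡⇒≡ᵇ≡true {y} refl = admissibleMarkings-forced a y r a<c
... | no y≢c rewrite ≢⇒≡ᵇ≡false y≢c =
  trans (admissibleMarkings-unconstrained a (y ∷ r) (just c) c4) (markedChains≡ (unmarked a) (y ∷ r))
  where
  c≢y : (c ≡ᵇ y) ≡ false
  c≢y = ≢⇒≡ᵇ≡false (y≢c ∘ sym)
  c4 : ∀ bs → cond4Below (unmarked a ∷ markRow (y ∷ r) bs) (just c) ≡ true
  c4 []           = cong not c≢y
  c4 (true ∷ bs)  = refl
  c4 (false ∷ bs) = cong not c≢y

-- Markings of a filling with unmarked first column

admissibleFilling : List (List Letter) → Bool
admissibleFilling []      = true
admissibleFilling (m ∷ M) = admissible m (leadingValue val M) ∧ admissibleFilling M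

admissibleMarkingsProduct : List (List ℕ) → ℕ
admissibleMarkingsProduct []      = 1
admissibleMarkingsProduct (r ∷ X) = admissibleMarkings r (leadingValue idℕ X) * admissibleMarkingsProduct X

leadingValue-markFilling : ∀ X B → leadingValue val (markFilling X B) ≡ leadingValue idℕ X
leadingValue-markFilling []            B             = refl
leadingValue-markFilling ([] ∷ X)      B             = refl
leadingValue-markFilling ((x ∷ r) ∷ X) []            = refl
leadingValue-markFilling ((x ∷ r) ∷ X) ([] ∷ B)      = refl
leadingValue-markFilling ((x ∷ r) ∷ X) ((b ∷ _) ∷ B) = cong just (val-mark x b)

∑-admissibleFilling : ∀ α X → ShapeOf α X →
  ∑[ B ← fillings α bools ] 𝟙 (admissibleFilling (markFilling X B)) ≡ admissibleMarkingsProduct X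
∑-admissibleFilling []      []      []            = refl
∑-admissibleFilling (a ∷ α) (r ∷ X) (refl ∷ shape) = begin
  ∑[ B ← fillings (length r ∷ α) bools ] 𝟙 (admissibleFilling (markFilling (r ∷ X) B))
    ≡⟨ ∑-fillings-cons (length r) α bools _ ⟩
  ∑[ bs ← ws ] ∑[ B ← fillings α bools ] 𝟙 (admissible (markRow r bs) (leadingValue val (markFilling X B)) ∧ admissibleFilling (markFilling X B))
    ≡⟨ ∑-cong ws (λ bs → ∑-cong (fillings α bools) (λ B → trans
         (cong (λ h → 𝟙 (admissible (markRow r bs) h ∧ admissibleFilling (markFilling X B))) (leadingValue-markFilling X B))
         (𝟙-∧ (admissible (markRow r bs) below) (admissibleFilling (markFilling X B))))) ⟩
  ∑[ bs ← ws ] ∑[ B ← fillings α bools ] (𝟙 (admissible (markRow r bs) below) * 𝟙 (admissibleFilling (markFilling X B)))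
    ≡⟨ ∑-cong ws (λ bs → trans (∑-*ˡ (fillings α bools) (𝟙 (admissible (markRow r bs) below)) _)
                               (cong (𝟙 (admissible (markRow r bs) below) *_) (∑-admissibleFilling α X shape))) ⟩
  ∑[ bs ← ws ] (𝟙 (admissible (markRow r bs) below) * admissibleMarkingsProduct X)
    ≡⟨ ∑-*ʳ ws (admissibleMarkingsProduct X) _ ⟩
  admissibleMarkings r below * admissibleMarkingsProduct X
    ∎
  where
  open ≡-Reasoning
  ws = words (length r) bools
  below = leadingValue idℕ X

mStat-cons : ∀ r X → mStat (r ∷ X) ≡ mBelow r (leadingValue idℕ X) + mStat X
mStat-cons r                 []            = refl
mStat-cons []                ([] ∷ X)      = refl
mStat-cons []                ((c ∷ s) ∷ X) = refl
mStat-cons (a ∷ [])          ([] ∷ X)      = refl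
mStat-cons (a ∷ [])          ((c ∷ s) ∷ X) = refl
mStat-cons (a ∷ b ∷ r)       ([] ∷ X)      = refl
mStat-cons (a ∷ b ∷ r)       ((c ∷ s) ∷ X) = refl

strictCol-tail : ∀ r X → strictCol (firstColumn (r ∷ X)) ≡ true → strictCol (firstColumn X) ≡ true
strictCol-tail []      X             s = s
strictCol-tail (a ∷ r) []            s = refl
strictCol-tail (a ∷ r) ([] ∷ X)      s = strictCol-tail (a ∷ r) X s
strictCol-tail (a ∷ r) ((c ∷ s) ∷ X) p = proj₂ (∧≡true⇒ p)

strictCol⇒StrictlyAbove : ∀ r X → strictCol (firstColumn (r ∷ X)) ≡ true → StrictlyAbove r (leadingValue idℕ X)
strictCol⇒StrictlyAbove []      X             _ = tt
strictCol⇒StrictlyAbove (a ∷ r) []            _ = tt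
strictCol⇒StrictlyAbove (a ∷ r) ([] ∷ X)      _ = tt
strictCol⇒StrictlyAbove (a ∷ r) ((c ∷ s) ∷ X) p = <ᵇ≡true⇒< {a} {c} (proj₁ (∧≡true⇒ p))

mBelow≤ascentsRow : ∀ r below → StrictlyAbove r below → mBelow r below ≤ ascentsRow r
mBelow≤ascentsRow r           nothing  _   = z≤n
mBelow≤ascentsRow []          (just c) _   = z≤n
mBelow≤ascentsRow (a ∷ [])    (just c) _   = z≤n
mBelow≤ascentsRow (a ∷ b ∷ r) (just c) a<c with b ≟ c
... | no b≢c rewrite ≢⇒≡ᵇ≡false b≢c = z≤n
... | yes refl rewrite ≡⇒≡ᵇ≡true {b} refl | ≢⇒≡ᵇ≡false (<⇒≢ a<c) = s≤s z≤n

mStat≤pStat : ∀ X → strictCol (firstColumn X) ≡ true → all (weaklyInc _≤ᵇ_) X ≡ true → mStat X ≤ pStat X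
mStat≤pStat []      _ _ = z≤n
mStat≤pStat (r ∷ X) s w = begin
  mStat (r ∷ X)                                      ≡⟨ mStat-cons r X ⟩
  mBelow r (leadingValue idℕ X) + mStat X            ≤⟨ +-mono-≤ (mBelow≤ascentsRow r _ (strictCol⇒StrictlyAbove r X s))
                                                                 (mStat≤pStat X (strictCol-tail r X s) (proj₂ (∧≡true⇒ w))) ⟩
  ascentsRow r + pStat X                             ≡⟨ cong (_+ pStat X) (distinct∸1≡ascentsRow r (proj₁ (∧≡true⇒ w))) ⟨
  pStat (r ∷ X)                                      ∎
  where open ≤-Reasoning

∸-+-∸ : ∀ {a m b n} → m ≤ a → n ≤ b → (a ∸ m) + (b ∸ n) ≡ (a + b) ∸ (m + n)
∸-+-∸ {a} {m} {b} {n} m≤a n≤b = begin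
  (a ∸ m) + (b ∸ n)  ≡⟨ +-∸-assoc (a ∸ m) n≤b ⟨
  (a ∸ m) + b ∸ n    ≡⟨ cong (_∸ n) (+-∸-comm b m≤a) ⟨
  (a + b) ∸ m ∸ n    ≡⟨ ∸-+-assoc (a + b) m n ⟩
  (a + b) ∸ (m + n)  ∎
  where open ≡-Reasoning

admissibleMarkingsProduct≡ : ∀ X → strictCol (firstColumn X) ≡ true →
  admissibleMarkingsProduct X ≡ 𝟙 (all (weaklyInc _≤ᵇ_) X) * 2 ^ (pStat X ∸ mStat X)
admissibleMarkingsProduct≡ []      _ = refl
admissibleMarkingsProduct≡ (r ∷ X) s = begin
  admissibleMarkings r below * admissibleMarkingsProduct X
    ≡⟨ cong₂ _*_ (admissibleMarkings≡ r below above) (admissibleMarkingsProduct≡ X s′) ⟩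
  𝟙 wr * 2 ^ (ascentsRow r ∸ mBelow r below) * (𝟙 wX * 2 ^ (pStat X ∸ mStat X))
    ≡⟨ 𝟙-*-2^ wr wX (ascentsRow r ∸ mBelow r below) (pStat X ∸ mStat X) ⟩
  𝟙 (wr ∧ wX) * 2 ^ ((ascentsRow r ∸ mBelow r below) + (pStat X ∸ mStat X))
    ≡⟨ 𝟙-*-cong (wr ∧ wX) (cong (2 ^_) ∘ exponent) ⟩
  𝟙 (wr ∧ wX) * 2 ^ (pStat (r ∷ X) ∸ mStat (r ∷ X))
    ∎
  where
  open ≡-Reasoning
  below = leadingValue idℕ X
  wr = weaklyInc _≤ᵇ_ r
  wX = all (weaklyInc _≤ᵇ_) X
  above = strictCol⇒StrictlyAbove r X s
  s′ = strictCol-tail r X s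
  exponent : (wr ∧ wX) ≡ true →
    (ascentsRow r ∸ mBelow r below) + (pStat X ∸ mStat X) ≡ pStat (r ∷ X) ∸ mStat (r ∷ X)
  exponent w = begin
    (ascentsRow r ∸ mBelow r below) + (pStat X ∸ mStat X)
      ≡⟨ ∸-+-∸ (mBelow≤ascentsRow r below above) (mStat≤pStat X s′ (proj₂ (∧≡true⇒ w))) ⟩
    (ascentsRow r + pStat X) ∸ (mBelow r below + mStat X)
      ≡⟨ cong₂ (λ a m → (a + pStat X) ∸ m) (distinct∸1≡ascentsRow r (proj₁ (∧≡true⇒ w))) (mStat-cons r X) ⟨
    pStat (r ∷ X) ∸ mStat (r ∷ X)
      ∎

rowsOK : List (List Letter) → Bool
rowsOK = all (λ r → weaklyInc _≤L_ r ∧ noRepeatedMarked r)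

firstColumnUnmarked : List (List Letter) → Bool
firstColumnUnmarked M = all (λ x → not (isMarked x)) (firstColumn M)

markedConditions : List (List Letter) → Bool
markedConditions M = rowsOK M ∧ (strictColL (firstColumn M) ∧ cond4 M)

allCond4Below : List (List Letter) → Bool
allCond4Below []      = true
allCond4Below (m ∷ M) = cond4Below m (leadingValue val M) ∧ allCond4Below M

rowsOK≡chains : ∀ M → rowsOK M ≡ all (weaklyInc precedes) M
rowsOK≡chains M = cong and (map-cong rowCondition≡chain M)

cond4≡allCond4Below : ∀ M → cond4 M ≡ allCond4Below M
cond4≡allCond4Below []                                  = refl
cond4≡allCond4Below (r ∷ [])                             = refl
cond4≡allCond4Below ([] ∷ [] ∷ M)                        = cond4≡allCond4Below ([] ∷ M)
cond4≡allCond4Below ([] ∷ (c ∷ s) ∷ M)                   = cond4≡allCond4Below ((c ∷ s) ∷ M)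
cond4≡allCond4Below ((a ∷ []) ∷ [] ∷ M)                  = cond4≡allCond4Below ([] ∷ M)
cond4≡allCond4Below ((a ∷ []) ∷ (c ∷ s) ∷ M)             = cond4≡allCond4Below ((c ∷ s) ∷ M)
cond4≡allCond4Below ((a ∷ marked i ∷ r) ∷ [] ∷ M)        = cond4≡allCond4Below ([] ∷ M)
cond4≡allCond4Below ((a ∷ marked i ∷ r) ∷ (c ∷ s) ∷ M)   = cond4≡allCond4Below ((c ∷ s) ∷ M)
cond4≡allCond4Below ((a ∷ unmarked i ∷ r) ∷ [] ∷ M)      = cond4≡allCond4Below ([] ∷ M)
cond4≡allCond4Below ((a ∷ unmarked i ∷ r) ∷ (c ∷ s) ∷ M) =
  cong (not (val c ≡ᵇ i) ∧_) (cond4≡allCond4Below ((c ∷ s) ∷ M))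

firstColumnUnmarked≡ : ∀ M → firstColumnUnmarked M ≡ all firstUnmarked M
firstColumnUnmarked≡ []             = refl
firstColumnUnmarked≡ ([] ∷ M)       = firstColumnUnmarked≡ M
firstColumnUnmarked≡ ((x ∷ r) ∷ M) = cong (not (isMarked x) ∧_) (firstColumnUnmarked≡ M)

admissibleFilling≡ : ∀ M → admissibleFilling M ≡ all (weaklyInc precedes) M ∧ (all firstUnmarked M ∧ allCond4Below M)
admissibleFilling≡ []      = refl
admissibleFilling≡ (m ∷ M) =
  trans (cong (admissible m (leadingValue val M) ∧_) (admissibleFilling≡ M))
        (regroup (weaklyInc precedes m) (firstUnmarked m) (cond4Below m (leadingValue val M))
                 (all (weaklyInc precedes) M) (all firstUnmarked M) (allCond4Below M))
  where
  regroup : ∀ c f d c′ f′ d′ → ((c ∧ (f ∧ d)) ∧ (c′ ∧ (f′ ∧ d′))) ≡ ((c ∧ c′) ∧ ((f ∧ f′) ∧ (d ∧ d′)))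
  regroup = solve 6 (λ c f d c′ f′ d′ → ((c ⊕ (f ⊕ d)) ⊕ (c′ ⊕ (f′ ⊕ d′))) ⊜ ((c ⊕ c′) ⊕ ((f ⊕ f′) ⊕ (d ⊕ d′)))) refl

firstColumn-unmarked : ∀ M → firstColumnUnmarked M ≡ true → firstColumn M ≡ map unmarked (firstColumn (map (map val) M))
firstColumn-unmarked []                      _ = refl
firstColumn-unmarked ([] ∷ M)                u = firstColumn-unmarked M u
firstColumn-unmarked ((unmarked x ∷ r) ∷ M) u = cong (unmarked x ∷_) (firstColumn-unmarked M u)

strictColL-unmarked : ∀ xs → strictColL (map unmarked xs) ≡ strictCol xs
strictColL-unmarked []           = refl
strictColL-unmarked (x ∷ [])     = refl
strictColL-unmarked (x ∷ y ∷ xs) = cong₂ _∧_ (<L-uu x y) (strictColL-unmarked (y ∷ xs))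

strictColL-markFilling : ∀ X B → firstColumnUnmarked (markFilling X B) ≡ true →
  strictColL (firstColumn (markFilling X B)) ≡ strictCol (firstColumn X)
strictColL-markFilling X B u = begin
  strictColL (firstColumn (markFilling X B))
    ≡⟨ cong strictColL (firstColumn-unmarked (markFilling X B) u) ⟩
  strictColL (map unmarked (firstColumn (map (map val) (markFilling X B))))
    ≡⟨ strictColL-unmarked (firstColumn (map (map val) (markFilling X B))) ⟩
  strictCol (firstColumn (map (map val) (markFilling X B)))
    ≡⟨ cong (strictCol ∘ firstColumn) (map-val-markFilling X B) ⟩
  strictCol (firstColumn X)
    ∎
  where open ≡-Reasoning

∧-regroup : ∀ c s s′ d f → (f ≡ true → s ≡ s′) → ((c ∧ (s ∧ d)) ∧ f) ≡ (s′ ∧ (c ∧ (f ∧ d)))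
∧-regroup c     s s′    d false _ rewrite ∧-zeroʳ (c ∧ (s ∧ d)) | ∧-zeroʳ c = sym (∧-zeroʳ s′)
∧-regroup false s s′    d true  h = sym (∧-zeroʳ s′)
∧-regroup true  s true  d true  h rewrite h refl = ∧-identityʳ d
∧-regroup true  s false d true  h rewrite h refl = refl

starConditions≡ : ∀ X B → (markedConditions (markFilling X B) ∧ firstColumnUnmarked (markFilling X B)) ≡
                          (strictCol (firstColumn X) ∧ admissibleFilling (markFilling X B))
starConditions≡ X B
  rewrite rowsOK≡chains (markFilling X B) | cond4≡allCond4Below (markFilling X B)
        | admissibleFilling≡ (markFilling X B) | sym (firstColumnUnmarked≡ (markFilling X B)) =
  ∧-regroup (all (weaklyInc precedes) (markFilling X B)) _ _ (allCond4Below (markFilling X B))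
            (firstColumnUnmarked (markFilling X B)) (strictColL-markFilling X B)

∑-starMarkings : ∀ α X → ShapeOf α X →
  ∑[ B ← fillings α bools ] 𝟙 (markedConditions (markFilling X B) ∧ firstColumnUnmarked (markFilling X B))
    ≡ 𝟙 (strictCol (firstColumn X)) * admissibleMarkingsProduct X
∑-starMarkings α X shape = begin
  ∑[ B ← fillings α bools ] 𝟙 (markedConditions (markFilling X B) ∧ firstColumnUnmarked (markFilling X B))
    ≡⟨ ∑-cong (fillings α bools) (λ B → trans (cong 𝟙 (starConditions≡ X B)) (𝟙-∧ sc _)) ⟩
  ∑[ B ← fillings α bools ] (𝟙 sc * 𝟙 (admissibleFilling (markFilling X B)))
    ≡⟨ ∑-*ˡ (fillings α bools) (𝟙 sc) _ ⟩
  𝟙 sc * ∑[ B ← fillings α bools ] 𝟙 (admissibleFilling (markFilling X B))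
    ≡⟨ cong (𝟙 sc *_) (∑-admissibleFilling α X shape) ⟩
  𝟙 sc * admissibleMarkingsProduct X
    ∎
  where
  open ≡-Reasoning
  sc = strictCol (firstColumn X)

-- Marks in the first column

clearFirst : List Bool → List Bool
clearFirst []      = []
clearFirst (_ ∷ bs) = false ∷ bs

clearFirstMarks : List (List Bool) → List (List Bool)
clearFirstMarks = map clearFirst

firstRow-clear : ∀ B → firstRow (clearFirstMarks B) ≡ clearFirst (firstRow B)
firstRow-clear []      = refl
firstRow-clear (_ ∷ _) = refl

drop1-clear : ∀ B → drop 1 (clearFirstMarks B) ≡ clearFirstMarks (drop 1 B)
drop1-clear []      = refl
drop1-clear (_ ∷ _) = refl

chain-head-val : ∀ x y r → val x ≡ val y → weaklyInc precedes (x ∷ r) ≡ weaklyInc precedes (y ∷ r)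
chain-head-val x y []      _  = refl
chain-head-val x y (z ∷ r) eq rewrite eq = refl

cond4Below-head : ∀ x y r below → cond4Below (x ∷ r) below ≡ cond4Below (y ∷ r) below
cond4Below-head x y r                nothing  = refl
cond4Below-head x y []               (just c) = refl
cond4Below-head x y (marked i ∷ r)   (just c) = refl
cond4Below-head x y (unmarked i ∷ r) (just c) = refl

chain-clearFirst : ∀ r bs → weaklyInc precedes (markRow r (clearFirst bs)) ≡ weaklyInc precedes (markRow r bs)
chain-clearFirst []      bs       = refl
chain-clearFirst (a ∷ r) []       = refl
chain-clearFirst (a ∷ r) (b ∷ bs) = chain-head-val (unmarked a) (mark a b) (markRow r bs) (sym (val-mark a b))

cond4Below-clearFirst : ∀ r bs below → cond4Below (markRow r (clearFirst bs)) below ≡ cond4Below (markRow r bs) below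
cond4Below-clearFirst []      bs       below = refl
cond4Below-clearFirst (a ∷ r) []       below = refl
cond4Below-clearFirst (a ∷ r) (b ∷ bs) below = cond4Below-head (unmarked a) (mark a b) (markRow r bs) below

chains-clear : ∀ X B → all (weaklyInc precedes) (markFilling X (clearFirstMarks B)) ≡ all (weaklyInc precedes) (markFilling X B)
chains-clear []      B = refl
chains-clear (r ∷ X) B rewrite firstRow-clear B | drop1-clear B =
  cong₂ _∧_ (chain-clearFirst r (firstRow B)) (chains-clear X (drop 1 B))

allCond4Below-clear : ∀ X B → allCond4Below (markFilling X (clearFirstMarks B)) ≡ allCond4Below (markFilling X B)
allCond4Below-clear []      B = refl
allCond4Below-clear (r ∷ X) B
  rewrite firstRow-clear B | drop1-clear B
        | leadingValue-markFilling X (clearFirstMarks (drop 1 B)) | leadingValue-markFilling X (drop 1 B) =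
  cong₂ _∧_ (cond4Below-clearFirst r (firstRow B) (leadingValue idℕ X)) (allCond4Below-clear X (drop 1 B))

NonemptyRows : {A : Set} → List (List A) → Set
NonemptyRows []            = ⊤
NonemptyRows ([] ∷ X)      = ⊥
NonemptyRows ((_ ∷ _) ∷ X) = NonemptyRows X

InRange : ℕ → ℕ → Set
InRange N x = 1 ≤ x × x ≤ N

InRange-posUpTo : ∀ N → All (InRange N) (posUpTo N)
InRange-posUpTo N = go (all-upTo N)
  where
  go : ∀ {js} → All (_< N) js → All (InRange N) (map suc js)
  go []           = []
  go (j<N ∷ j<Ns) = (s≤s z≤n , j<N) ∷ go j<Ns

nonzero : ℕ → Bool
nonzero c = not (c ≡ᵇ 0)

Peaked : ℕ → List (List ℕ) → Set
Peaked N X = ∀ k → 1 ≤ k → k ≤ N → noOneBeforeLast (filterᵇ nonzero (map (countLe idℕ k) X)) ≡ true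

peakCondition⇒Peaked : ∀ N X → peakCondition idℕ N X ≡ true → Peaked N X
peakCondition⇒Peaked N X e (suc j) _ j<N =
  proj₂ (∧≡true⇒ (all⇒∈ (λ j → peakAt idℕ X (suc j)) (∈-upTo⁺ j<N) e))

Peaked-tail : ∀ N r X → Peaked N (r ∷ X) → Peaked N X
Peaked-tail N r X peaked k 1≤k k≤N with nonzero (countLe idℕ k r) | peaked k 1≤k k≤N
... | true  | p = noOneBeforeLast-tail (countLe idℕ k r) (filterᵇ nonzero (map (countLe idℕ k) X)) p
  where
  noOneBeforeLast-tail : ∀ x ys → noOneBeforeLast (x ∷ ys) ≡ true → noOneBeforeLast ys ≡ true
  noOneBeforeLast-tail x []       _ = refl
  noOneBeforeLast-tail x (y ∷ ys) p = proj₂ (∧≡true⇒ p)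
... | false | p = p

countLe-above : ∀ a xs → All (a <_) xs → countLe idℕ a xs ≡ 0
countLe-above a []       []           = refl
countLe-above a (x ∷ xs) (a<x ∷ a<xs) rewrite >⇒≤ᵇ≡false a<x = countLe-above a xs a<xs

countLe-self : ∀ a xs → countLe idℕ a (a ∷ xs) ≡ suc (countLe idℕ a xs)
countLe-self a xs rewrite ≤⇒≤ᵇ≡true (≤-refl {a}) = refl

chain⇒values : ∀ m → weaklyInc precedes m ≡ true → weaklyInc _≤ᵇ_ (map val m) ≡ true
chain⇒values []          _ = refl
chain⇒values (x ∷ [])     _ = refl
chain⇒values (x ∷ y ∷ m) c =
  ⇒∧≡true (≤⇒≤ᵇ≡true (precedes⇒val≤ x y (proj₁ (∧≡true⇒ c)))) (chain⇒values (y ∷ m) (proj₂ (∧≡true⇒ c)))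

-- Condition (4) with the entry below equal to a keeps an unmarked a out of second place,
-- and the chain keeps out a second a′.
rest-above : ∀ a r bs → weaklyInc precedes (marked a ∷ markRow r bs) ≡ true →
  cond4Below (marked a ∷ markRow r bs) (just a) ≡ true → All (a <_) r
rest-above a []      bs c c4 = []
rest-above a (z ∷ r) bs c c4 =
  All.map (λ {y} z≤y → <-≤-trans (a<z bs c c4) (≤ᵇ≡true⇒≤ {z} {y} z≤y)) (≤⇒≤ᵇ≡true (≤-refl {z}) ∷ z≤r)
  where
  z≤r : All (λ y → (z ≤ᵇ y) ≡ true) r
  z≤r = weaklyInc-head _≤ᵇ_ ≤ᵇ-trans z r
    (subst (λ v → weaklyInc _≤ᵇ_ v ≡ true) (map-val-markRow (z ∷ r) bs)
           (chain⇒values (markRow (z ∷ r) bs) (weaklyInc-tail precedes (marked a) (markRow (z ∷ r) bs) c)))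
  a<z : ∀ bs → weaklyInc precedes (marked a ∷ markRow (z ∷ r) bs) ≡ true →
    cond4Below (marked a ∷ markRow (z ∷ r) bs) (just a) ≡ true → a < z
  a<z (true ∷ _)  c _  = <ᵇ≡true⇒< {a} {z} (proj₁ (∧≡true⇒ c))
  a<z (false ∷ _) c c4 = ≤∧≢⇒< (≤ᵇ≡true⇒≤ {a} {z} (proj₁ (∧≡true⇒ c))) (λ a≡z → not≡true⇒≢ c4 (≡⇒≡ᵇ≡true a≡z))
  a<z []          c c4 = ≤∧≢⇒< (≤ᵇ≡true⇒≤ {a} {z} (proj₁ (∧≡true⇒ c))) (λ a≡z → not≡true⇒≢ c4 (≡⇒≡ᵇ≡true a≡z))

firstLetter : ℕ → List Bool → Letter
firstLetter a []      = unmarked a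
firstLetter a (b ∷ _) = mark a b

val-firstLetter : ∀ a bs → val (firstLetter a bs) ≡ a
val-firstLetter a []      = refl
val-firstLetter a (b ∷ _) = val-mark a b

firstLetter-clearFirst : ∀ a bs → firstLetter a (clearFirst bs) ≡ unmarked a
firstLetter-clearFirst a []      = refl
firstLetter-clearFirst a (_ ∷ _) = refl

firstColumn-markRow : ∀ a r bs M → firstColumn (markRow (a ∷ r) bs ∷ M) ≡ firstLetter a bs ∷ firstColumn M
firstColumn-markRow a r []           M = refl
firstColumn-markRow a r (true ∷ _)  M = refl
firstColumn-markRow a r (false ∷ _) M = refl

-- Reading k = a, a row that starts with a′ has exactly one entry ≤ a, while the row below,
-- starting with a, has at least one: a part 1 that is not last.
marked-above-equal-impossible : ∀ N a r bs s X → isMarked (firstLetter a bs) ≡ true →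
  weaklyInc precedes (markRow (a ∷ r) bs) ≡ true → cond4Below (markRow (a ∷ r) bs) (just a) ≡ true →
  1 ≤ a → a ≤ N → ¬ Peaked N ((a ∷ r) ∷ (a ∷ s) ∷ X)
marked-above-equal-impossible N a r (true ∷ bs) s X _ c c4 1≤a a≤N peaked =
  case trans (sym notPeak) (peaked a 1≤a a≤N) of λ ()
  where
  one : countLe idℕ a (a ∷ r) ≡ 1
  one = trans (countLe-self a r) (cong suc (countLe-above a r (rest-above a r bs c c4)))
  notPeak : noOneBeforeLast (filterᵇ nonzero (map (countLe idℕ a) ((a ∷ r) ∷ (a ∷ s) ∷ X))) ≡ false
  notPeak rewrite one | countLe-self a s = refl

<L-unmark : ∀ x y → ¬ (isMarked x ≡ true × isMarked y ≡ false × val x ≡ val y) →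
  (x <L y) ≡ (unmarked (val x) <L unmarked (val y))
<L-unmark (marked a)   (marked c)   _ = trans (<L-mm a c) (sym (<L-uu a c))
<L-unmark (unmarked a) (marked c)   _ = trans (<L-um a c) (sym (<L-uu a c))
<L-unmark (unmarked a) (unmarked c) _ = refl
<L-unmark (marked a)   (unmarked c) h = trans (<L-mu a c) (trans ≤ᵇ≡<ᵇ (sym (<L-uu a c)))
  where
  ≤ᵇ≡<ᵇ : (a ≤ᵇ c) ≡ (a <ᵇ c)
  ≤ᵇ≡<ᵇ with <-cmp a c
  ... | tri< a<c _ _ = trans (≤⇒≤ᵇ≡true (<⇒≤ a<c)) (sym (<⇒<ᵇ≡true a<c))
  ... | tri≈ _ a≡c _ = ⊥-elim (h (refl , refl , a≡c))
  ... | tri> _ _ a>c = trans (>⇒≤ᵇ≡false a>c) (sym (≥⇒<ᵇ≡false (<⇒≤ a>c)))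

strictColL-cons₂ : ∀ a r c s Y B → strictColL (firstColumn (markFilling ((a ∷ r) ∷ (c ∷ s) ∷ Y) B)) ≡
  ((firstLetter a (firstRow B) <L firstLetter c (firstRow (drop 1 B)))
    ∧ strictColL (firstColumn (markFilling ((c ∷ s) ∷ Y) (drop 1 B))))
strictColL-cons₂ a r c s Y B
  rewrite firstColumn-markRow a r (firstRow B) (markFilling ((c ∷ s) ∷ Y) (drop 1 B))
        | firstColumn-markRow c s (firstRow (drop 1 B)) (markFilling Y (drop 1 (drop 1 B))) = refl

strictColL-single : ∀ a r B → strictColL (firstColumn (markFilling ((a ∷ r) ∷ []) B)) ≡ true
strictColL-single a r B rewrite firstColumn-markRow a r (firstRow B) [] = refl

-- Clearing the marks of the first column can only change a comparison a′ < a between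
-- consecutive first-column entries, and such a pair never occurs.
strictColL-clear : ∀ N X B → NonemptyRows X → All (All (InRange N)) X → Peaked N X →
  all (weaklyInc precedes) (markFilling X B) ≡ true → allCond4Below (markFilling X B) ≡ true →
  strictColL (firstColumn (markFilling X B)) ≡ strictColL (firstColumn (markFilling X (clearFirstMarks B)))
strictColL-clear N []                  B _ _ _ _ _ = refl
strictColL-clear N ((a ∷ r) ∷ [])      B _ _ _ _ _ =
  trans (strictColL-single a r B) (sym (strictColL-single a r (clearFirstMarks B)))
strictColL-clear N ((a ∷ r) ∷ (c ∷ s) ∷ Y) B ne ((a∈ ∷ _) ∷ in-range) peaked chains c4s = begin
  strictColL (firstColumn (markFilling X B))
    ≡⟨ strictColL-cons₂ a r c s Y B ⟩
  (x <L y) ∧ strictColL (firstColumn (markFilling X′ (drop 1 B)))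
    ≡⟨ cong₂ _∧_ x<y≡a<c rest ⟩
  (unmarked a <L unmarked c) ∧ strictColL (firstColumn (markFilling X′ (clearFirstMarks (drop 1 B))))
    ≡⟨ cong₂ (λ u v → (u <L v) ∧ strictColL (firstColumn (markFilling X′ (clearFirstMarks (drop 1 B)))))
             (unmark a B) (unmark c (drop 1 B)) ⟨
  (firstLetter a (firstRow (clearFirstMarks B)) <L firstLetter c (firstRow (clearFirstMarks (drop 1 B))))
    ∧ strictColL (firstColumn (markFilling X′ (clearFirstMarks (drop 1 B))))
    ≡⟨ cong (λ B′ → (firstLetter a (firstRow (clearFirstMarks B)) <L firstLetter c (firstRow B′))
                    ∧ strictColL (firstColumn (markFilling X′ B′))) (drop1-clear B) ⟨
  (firstLetter a (firstRow (clearFirstMarks B)) <L firstLetter c (firstRow (drop 1 (clearFirstMarks B))))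
    ∧ strictColL (firstColumn (markFilling X′ (drop 1 (clearFirstMarks B))))
    ≡⟨ strictColL-cons₂ a r c s Y (clearFirstMarks B) ⟨
  strictColL (firstColumn (markFilling X (clearFirstMarks B)))
    ∎
  where
  open ≡-Reasoning
  X = (a ∷ r) ∷ (c ∷ s) ∷ Y
  X′ = (c ∷ s) ∷ Y
  x = firstLetter a (firstRow B)
  y = firstLetter c (firstRow (drop 1 B))
  unmark : ∀ a B → firstLetter a (firstRow (clearFirstMarks B)) ≡ unmarked a
  unmark a B = trans (cong (firstLetter a) (firstRow-clear B)) (firstLetter-clearFirst a (firstRow B))
  chain₁ : weaklyInc precedes (markRow (a ∷ r) (firstRow B)) ≡ true
  chain₁ = proj₁ (∧≡true⇒ chains)
  c4₁ : cond4Below (markRow (a ∷ r) (firstRow B)) (just c) ≡ true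
  c4₁ = subst (λ h → cond4Below (markRow (a ∷ r) (firstRow B)) h ≡ true)
              (leadingValue-markFilling X′ (drop 1 B)) (proj₁ (∧≡true⇒ c4s))
  rest : strictColL (firstColumn (markFilling X′ (drop 1 B)))
       ≡ strictColL (firstColumn (markFilling X′ (clearFirstMarks (drop 1 B))))
  rest = strictColL-clear N X′ (drop 1 B) ne in-range (Peaked-tail N (a ∷ r) X′ peaked)
                          (proj₂ (∧≡true⇒ {weaklyInc precedes (markRow (a ∷ r) (firstRow B))} chains))
                          (proj₂ (∧≡true⇒ {cond4Below (markRow (a ∷ r) (firstRow B)) (leadingValue val (markFilling X′ (drop 1 B)))}
                                          c4s))
  no-a′-over-a : ¬ (isMarked x ≡ true × isMarked y ≡ false × val x ≡ val y)
  no-a′-over-a (x-marked , _ , x≡y)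
    with trans (sym (val-firstLetter a (firstRow B))) (trans x≡y (val-firstLetter c (firstRow (drop 1 B))))
  ... | refl = marked-above-equal-impossible N a r (firstRow B) s Y x-marked chain₁ c4₁ (proj₁ a∈) (proj₂ a∈) peaked
  x<y≡a<c : (x <L y) ≡ (unmarked a <L unmarked c)
  x<y≡a<c = trans (<L-unmark x y no-a′-over-a)
                  (cong₂ (λ u v → unmarked u <L unmarked v)
                         (val-firstLetter a (firstRow B)) (val-firstLetter c (firstRow (drop 1 B))))

noFirstMarks : List (List Bool) → Bool
noFirstMarks []            = true
noFirstMarks ([] ∷ B)      = noFirstMarks B
noFirstMarks ((b ∷ _) ∷ B) = not b ∧ noFirstMarks B

-- Each row contributes a factor 2: both values of its first mark are sent to `false`.
∑-clearFirstMarks : ∀ α → isComposition α ≡ true → (f : List (List Bool) → ℕ) →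
  ∑[ B ← fillings α bools ] f (clearFirstMarks B) ≡ 2 ^ length α * ∑[ B ← fillings α bools ] (𝟙 (noFirstMarks B) * f B)
∑-clearFirstMarks []          _ f = sym (trans (*-identityˡ _) (cong (_+ 0) (*-identityˡ (f []))))
∑-clearFirstMarks (suc n ∷ α) c f = begin
  ∑[ B ← fillings (suc n ∷ α) bools ] f (clearFirstMarks B)
    ≡⟨ ∑-fillings-cons (suc n) α bools (f ∘ clearFirstMarks) ⟩
  ∑[ bs ← words (suc n) bools ] ∑[ B ← fillings α bools ] f (clearFirst bs ∷ clearFirstMarks B)
    ≡⟨ ∑-words-suc n bools (λ bs → ∑[ B ← fillings α bools ] f (clearFirst bs ∷ clearFirstMarks B)) ⟩
  cleared + (cleared + 0)
    ≡⟨ cong (λ z → z + (z + 0)) (trans (∑-cong ws (λ bs → ∑-clearFirstMarks α c (λ B → f ((false ∷ bs) ∷ B))))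
                                       (∑-*ˡ ws 2^ℓ (λ bs → g (false ∷ bs)))) ⟩
  2^ℓ * unmarkedFirst + (2^ℓ * unmarkedFirst + 0)
    ≡⟨ doubling 2^ℓ unmarkedFirst ⟩
  2 * 2^ℓ * (0 + (unmarkedFirst + 0))
    ≡⟨ cong (λ z → 2 * 2^ℓ * (z + (unmarkedFirst + 0))) markedFirst ⟨
  2 * 2^ℓ * (∑[ bs ← ws ] g (true ∷ bs) + (unmarkedFirst + 0))
    ≡⟨ cong (2 * 2^ℓ *_) (∑-words-suc n bools g) ⟨
  2 * 2^ℓ * ∑[ bs ← words (suc n) bools ] ∑[ B ← fillings α bools ] h (bs ∷ B)
    ≡⟨ cong (2 * 2^ℓ *_) (∑-fillings-cons (suc n) α bools h) ⟨
  2 * 2^ℓ * ∑[ B ← fillings (suc n ∷ α) bools ] h B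
    ∎
  where
  open ≡-Reasoning
  2^ℓ = 2 ^ length α
  h : List (List Bool) → ℕ
  h B = 𝟙 (noFirstMarks B) * f B
  g : List Bool → ℕ
  g bs = ∑[ B ← fillings α bools ] h (bs ∷ B)
  ws = words n bools
  cleared = ∑[ bs ← ws ] ∑[ B ← fillings α bools ] f ((false ∷ bs) ∷ clearFirstMarks B)
  unmarkedFirst = ∑[ bs ← ws ] g (false ∷ bs)
  markedFirst : ∑[ bs ← ws ] g (true ∷ bs) ≡ 0
  markedFirst = trans (∑-cong ws (λ _ → ∑-zero (fillings α bools))) (∑-zero ws)
  doubling : ∀ p x → p * x + (p * x + 0) ≡ 2 * p * (0 + (x + 0))
  doubling = solve-∀

markedConditions-clear : ∀ N X B → NonemptyRows X → All (All (InRange N)) X → Peaked N X →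
  markedConditions (markFilling X B) ≡ markedConditions (markFilling X (clearFirstMarks B))
markedConditions-clear N X B ne in-range peaked
  rewrite rowsOK≡chains (markFilling X B) | rowsOK≡chains (markFilling X (clearFirstMarks B))
        | cond4≡allCond4Below (markFilling X B) | cond4≡allCond4Below (markFilling X (clearFirstMarks B))
        | chains-clear X B | allCond4Below-clear X B
  with all (weaklyInc precedes) (markFilling X B) in chains | allCond4Below (markFilling X B) in c4s
... | false | _     = refl
... | true  | false = trans (∧-zeroʳ (strictColL (firstColumn (markFilling X B))))
                            (sym (∧-zeroʳ (strictColL (firstColumn (markFilling X (clearFirstMarks B))))))
... | true  | true  = cong (_∧ true) (strictColL-clear N X B ne in-range peaked chains c4s)

noFirstMarks≡ : ∀ α X B → isComposition α ≡ true → ShapeOf α X → ShapeOf α B →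
  noFirstMarks B ≡ firstColumnUnmarked (markFilling X B)
noFirstMarks≡ []          []            []                  _ []      []      = refl
noFirstMarks≡ (suc a ∷ α) ((x ∷ r) ∷ X) ((true ∷ bs) ∷ B)  _ _       _       = refl
noFirstMarks≡ (suc a ∷ α) ((x ∷ r) ∷ X) ((false ∷ bs) ∷ B) c (_ ∷ sX) (_ ∷ sB) = noFirstMarks≡ α X B c sX sB
noFirstMarks≡ (suc a ∷ α) X            ([] ∷ B)           _ _        (() ∷ _)
noFirstMarks≡ (suc a ∷ α) ([] ∷ X)     ((true ∷ bs) ∷ B)  _ (() ∷ _) _

NonemptyRows-shape : ∀ α (X : List (List ℕ)) → isComposition α ≡ true → ShapeOf α X → NonemptyRows X
NonemptyRows-shape []          []            _ []        = tt
NonemptyRows-shape (suc a ∷ α) ((x ∷ r) ∷ X) c (_ ∷ sX) = NonemptyRows-shape α X c sX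

∑-markedConditions : ∀ N α X → isComposition α ≡ true → ShapeOf α X → All (All (InRange N)) X → Peaked N X →
  ∑[ B ← fillings α bools ] 𝟙 (markedConditions (markFilling X B))
    ≡ 2 ^ length α * ∑[ B ← fillings α bools ] 𝟙 (markedConditions (markFilling X B) ∧ firstColumnUnmarked (markFilling X B))
∑-markedConditions N α X c shape in-range peaked = begin
  ∑[ B ← fillings α bools ] 𝟙 (markedConditions (markFilling X B))
    ≡⟨ ∑-cong (fillings α bools) (λ B → cong 𝟙 (markedConditions-clear N X B ne in-range peaked)) ⟩
  ∑[ B ← fillings α bools ] 𝟙 (markedConditions (markFilling X (clearFirstMarks B)))
    ≡⟨ ∑-clearFirstMarks α c (λ B → 𝟙 (markedConditions (markFilling X B))) ⟩
  2 ^ length α * ∑[ B ← fillings α bools ] (𝟙 (noFirstMarks B) * 𝟙 (markedConditions (markFilling X B)))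
    ≡⟨ cong (2 ^ length α *_)
            (∑-cong-fillings {P = λ _ → ⊤} α bools (tt ∷ tt ∷ []) (λ B sB _ → unmarkedFirstColumn B sB)) ⟩
  2 ^ length α * ∑[ B ← fillings α bools ] 𝟙 (markedConditions (markFilling X B) ∧ firstColumnUnmarked (markFilling X B))
    ∎
  where
  open ≡-Reasoning
  ne = NonemptyRows-shape α X c shape
  unmarkedFirstColumn : ∀ B → ShapeOf α B →
    𝟙 (noFirstMarks B) * 𝟙 (markedConditions (markFilling X B))
      ≡ 𝟙 (markedConditions (markFilling X B) ∧ firstColumnUnmarked (markFilling X B))
  unmarkedFirstColumn B sB rewrite noFirstMarks≡ α X B c shape sB =
    trans (*-comm (𝟙 (firstColumnUnmarked (markFilling X B))) _) (sym (𝟙-∧ (markedConditions (markFilling X B)) _))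

-- The generating functions

valueConditions : List ℕ → List (List ℕ) → Bool
valueConditions α X = peakCondition idℕ (size α) X ∧ weightIsComposition idℕ X

isMPCT-markFilling : ∀ α X B →
  𝟙 (isMPCT α (markFilling X B)) ≡ 𝟙 (valueConditions α X) * 𝟙 (markedConditions (markFilling X B))
isMPCT-markFilling α X B = trans (cong 𝟙 reorder) (𝟙-∧ (valueConditions α X) (markedConditions (markFilling X B)))
  where
  regroup : ∀ r s p c w → (r ∧ (s ∧ (p ∧ (c ∧ w)))) ≡ ((p ∧ w) ∧ (r ∧ (s ∧ c)))
  regroup = solve 5 (λ r s p c w → (r ⊕ (s ⊕ (p ⊕ (c ⊕ w)))) ⊜ ((p ⊕ w) ⊕ (r ⊕ (s ⊕ c)))) refl
  reorder : isMPCT α (markFilling X B) ≡ (valueConditions α X ∧ markedConditions (markFilling X B))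
  reorder rewrite peakCondition-markFilling (size α) X B | wt-markFilling X B =
    regroup (rowsOK (markFilling X B)) (strictColL (firstColumn (markFilling X B)))
            (peakCondition idℕ (size α) X) (cond4 (markFilling X B)) (weightIsComposition idℕ X)

PCT-summand : List ℕ → List ℕ → List (List ℕ) → ℕ
PCT-summand α γ X = 𝟙 (isPCT α X) * (2 ^ (pStat X ∸ mStat X) * M (wt idℕ X) γ)

MPCT-summand : List ℕ → List ℕ → (List (List Letter) → Bool) → List (List Letter) → ℕ
MPCT-summand α γ extra Y = 𝟙 (isMPCT α Y) * (𝟙 (extra Y) * M (wt val Y) γ)

∑-markings-MPCT-summand : ∀ α γ X (extra : List (List Letter) → Bool) →
  ∑[ B ← fillings α bools ] MPCT-summand α γ extra (markFilling X B)
    ≡ 𝟙 (valueConditions α X) * M (wt idℕ X) γ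
      * ∑[ B ← fillings α bools ] 𝟙 (markedConditions (markFilling X B) ∧ extra (markFilling X B))
∑-markings-MPCT-summand α γ X extra =
  trans (∑-cong (fillings α bools) summand) (∑-*ˡ (fillings α bools) (𝟙 (valueConditions α X) * M (wt idℕ X) γ) _)
  where
  rearrange : ∀ v c e m → v * c * (e * m) ≡ v * m * (c * e)
  rearrange = solve-∀
  summand : ∀ B → MPCT-summand α γ extra (markFilling X B)
                ≡ 𝟙 (valueConditions α X) * M (wt idℕ X) γ * 𝟙 (markedConditions (markFilling X B) ∧ extra (markFilling X B))
  summand B
    rewrite isMPCT-markFilling α X B | wt-markFilling X B | 𝟙-∧ (markedConditions (markFilling X B)) (extra (markFilling X B)) =
    rearrange (𝟙 (valueConditions α X)) (𝟙 (markedConditions (markFilling X B))) (𝟙 (extra (markFilling X B)))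
              (M (wt idℕ X) γ)

PCT-summand≡ : ∀ α γ X →
  PCT-summand α γ X ≡ 𝟙 (valueConditions α X) * M (wt idℕ X) γ * (𝟙 (strictCol (firstColumn X)) * admissibleMarkingsProduct X)
PCT-summand≡ α γ X with strictCol (firstColumn X) in sc
... | false rewrite ∧-zeroʳ (all (weaklyInc _≤ᵇ_) X) = sym (*-zeroʳ (𝟙 (valueConditions α X) * M (wt idℕ X) γ))
... | true  rewrite admissibleMarkingsProduct≡ X sc | 𝟙-∧ (all (weaklyInc _≤ᵇ_) X) (valueConditions α X) =
  rearrange (𝟙 (all (weaklyInc _≤ᵇ_) X)) (𝟙 (valueConditions α X)) (2 ^ (pStat X ∸ mStat X)) (M (wt idℕ X) γ)
  where
  rearrange : ∀ w v p m → w * v * (p * m) ≡ v * m * (1 * (w * p))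
  rearrange = solve-∀

starSum≡PCT-summand : ∀ α γ X → ShapeOf α X →
  𝟙 (valueConditions α X) * M (wt idℕ X) γ
    * ∑[ B ← fillings α bools ] 𝟙 (markedConditions (markFilling X B) ∧ firstColumnUnmarked (markFilling X B))
  ≡ PCT-summand α γ X
starSum≡PCT-summand α γ X shape =
  trans (cong (𝟙 (valueConditions α X) * M (wt idℕ X) γ *_) (∑-starMarkings α X shape)) (sym (PCT-summand≡ α γ X))

∑-markings-unmarkedFirstColumn : ∀ α γ X → ShapeOf α X →
  ∑[ B ← fillings α bools ] MPCT-summand α γ firstColumnUnmarked (markFilling X B) ≡ PCT-summand α γ X
∑-markings-unmarkedFirstColumn α γ X shape =
  trans (∑-markings-MPCT-summand α γ X firstColumnUnmarked) (starSum≡PCT-summand α γ X shape)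

∑-markings-anyFirstColumn : ∀ α γ X → isComposition α ≡ true → ShapeOf α X → All (All (InRange (size α))) X →
  ∑[ B ← fillings α bools ] MPCT-summand α γ (λ _ → true) (markFilling X B) ≡ 2 ^ length α * PCT-summand α γ X
∑-markings-anyFirstColumn α γ X c shape in-range = begin
  ∑[ B ← Bs ] MPCT-summand α γ (λ _ → true) (markFilling X B)
    ≡⟨ ∑-markings-MPCT-summand α γ X (λ _ → true) ⟩
  𝟙 v * Mγ * ∑[ B ← Bs ] 𝟙 (markedConditions (markFilling X B) ∧ true)
    ≡⟨ cong (𝟙 v * Mγ *_) (∑-cong Bs (λ B → cong 𝟙 (∧-identityʳ (markedConditions (markFilling X B))))) ⟩
  𝟙 v * Mγ * ∑[ B ← Bs ] 𝟙 (markedConditions (markFilling X B))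
    ≡⟨ *-assoc (𝟙 v) Mγ _ ⟩
  𝟙 v * (Mγ * ∑[ B ← Bs ] 𝟙 (markedConditions (markFilling X B)))
    ≡⟨ 𝟙-*-cong v (λ v≡true → cong (Mγ *_) (∑-markedConditions (size α) α X c shape in-range
                                               (peakCondition⇒Peaked (size α) X (proj₁ (∧≡true⇒ v≡true))))) ⟩
  𝟙 v * (Mγ * (2 ^ length α * star))
    ≡⟨ rearrange (𝟙 v) Mγ (2 ^ length α) star ⟩
  2 ^ length α * (𝟙 v * Mγ * star)
    ≡⟨ cong (2 ^ length α *_) (starSum≡PCT-summand α γ X shape) ⟩
  2 ^ length α * PCT-summand α γ X
    ∎
  where
  open ≡-Reasoning
  Bs = fillings α bools
  v = valueConditions α X
  Mγ = M (wt idℕ X) γ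
  star = ∑[ B ← Bs ] 𝟙 (markedConditions (markFilling X B) ∧ firstColumnUnmarked (markFilling X B))
  rearrange : ∀ u m p s → u * (m * (p * s)) ≡ p * (u * m * s)
  rearrange = solve-∀

Phat≡ : ∀ α γ → Phat α γ ≡ ∑[ X ← fillings α (posUpTo (size α)) ] PCT-summand α γ X
Phat≡ α γ = ∑-filterᵇ (isPCT α) (fillings α (posUpTo (size α))) (λ X → 2 ^ (pStat X ∸ mStat X) * M (wt idℕ X) γ)

sumM-MPCT*≡ : ∀ α γ →
  sumM (MPCT* α) γ
    ≡ ∑[ X ← fillings α (posUpTo (size α)) ] ∑[ B ← fillings α bools ] MPCT-summand α γ firstColumnUnmarked (markFilling X B)
sumM-MPCT*≡ α γ =
  trans (∑-filterᵇ firstColumnUnmarked (MPCT α) (λ Y → M (wt val Y) γ))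
  (trans (∑-filterᵇ (isMPCT α) (fillings α (lettersUpTo (size α))) (λ Y → 𝟙 (firstColumnUnmarked Y) * M (wt val Y) γ))
         (∑-letterFillings α (MPCT-summand α γ firstColumnUnmarked)))

sumM-MPCT≡ : ∀ α γ →
  sumM (MPCT α) γ
    ≡ ∑[ X ← fillings α (posUpTo (size α)) ] ∑[ B ← fillings α bools ] MPCT-summand α γ (λ _ → true) (markFilling X B)
sumM-MPCT≡ α γ =
  trans (∑-filterᵇ (isMPCT α) (fillings α (lettersUpTo (size α))) (λ Y → M (wt val Y) γ))
  (trans (∑-cong (fillings α (lettersUpTo (size α)))
                 (λ Y → cong (𝟙 (isMPCT α Y) *_) (sym (*-identityˡ (M (wt val Y) γ)))))
         (∑-letterFillings α (MPCT-summand α γ (λ _ → true))))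

mainTheorem1 : (α : List ℕ) → T (isPeakComposition α) →
    ((γ : List ℕ) → Phat α γ ≡ sumM (MPCT* α) γ) ×
    ((γ : List ℕ) → Qhat α γ ≡ sumM (MPCT α) γ)
mainTheorem1 α peak = Phat≡sumM , Qhat≡sumM
  where
  composition : isComposition α ≡ true
  composition = proj₁ (∧≡true⇒ (T⇒≡true peak))
  Xs = fillings α (posUpTo (size α))
  Bs = fillings α bools
  Phat≡sumM : ∀ γ → Phat α γ ≡ sumM (MPCT* α) γ
  Phat≡sumM γ = begin
    Phat α γ
      ≡⟨ Phat≡ α γ ⟩
    ∑[ X ← Xs ] PCT-summand α γ X
      ≡⟨ ∑-cong-fillings α _ (InRange-posUpTo (size α)) (λ X shape _ → ∑-markings-unmarkedFirstColumn α γ X shape) ⟨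
    ∑[ X ← Xs ] ∑[ B ← Bs ] MPCT-summand α γ firstColumnUnmarked (markFilling X B)
      ≡⟨ sumM-MPCT*≡ α γ ⟨
    sumM (MPCT* α) γ
      ∎
    where open ≡-Reasoning
  Qhat≡sumM : ∀ γ → Qhat α γ ≡ sumM (MPCT α) γ
  Qhat≡sumM γ = begin
    2 ^ length α * Phat α γ
      ≡⟨ cong (2 ^ length α *_) (Phat≡ α γ) ⟩
    2 ^ length α * ∑[ X ← Xs ] PCT-summand α γ X
      ≡⟨ ∑-*ˡ Xs (2 ^ length α) (PCT-summand α γ) ⟨
    ∑[ X ← Xs ] (2 ^ length α * PCT-summand α γ X)
      ≡⟨ ∑-cong-fillings α _ (InRange-posUpTo (size α))
           (λ X shape in-range → ∑-markings-anyFirstColumn α γ X composition shape in-range) ⟨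
    ∑[ X ← Xs ] ∑[ B ← Bs ] MPCT-summand α γ (λ _ → true) (markFilling X B)
      ≡⟨ sumM-MPCT≡ α γ ⟨
    sumM (MPCT α) γ
      ∎
    where open ≡-Reasoning
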